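{- Any nondeterministic circuit of size $s$ and width $w$ can be converted to a deterministic circuit computing the same function, of size $2^{O((w + \log s)\log s)}$ and width $w + O(\log s)$.
   Context: Circuits are directed acyclic graphs whose in-degree-0 nodes (inputs) are labeled by a variable or a constant 0 or 1, and whose other nodes (gates) are AND gates of fan-in two, OR gates of fan-in two, or NOT gates; one node is the output. The size is the number of gates. For the width, every edge jumping over layers is subdivided by COPY gates (dummy gates outputting their input) so that the circuit is layered (every edge goes between adjacent layers); the width of a layer is its number of gates and the width of the circuit is the maximum layer width. A nondeterministic circuit has actual inputs $x_1,\dots,x_n$ and guess inputs $y_1,\dots,y_m$; it computes $f$ where $f(x)=1$ iff some setting of the guess inputs makes the circuit output 1. In a nondeterministic circuit each guess input labels at most one node, while actual inputs may label arbitrarily many nodes. A deterministic circuit has no guess inputs. -}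

module Defs where

open import Data.Nat using (ℕ; zero; suc; _+_; _*_; _^_; _≤_; _<_; _<ᵇ_; _≡ᵇ_)
open import Data.Nat.Logarithm using (⌈log₂_⌉)
open import Data.Bool using (Bool; true; false; _∧_; _∨_; not)
open import Data.Fin using (Fin; fromℕ; inject₁; _≟_)
open import Relation.Nullary.Decidable using (⌊_⌋)
open import Data.List.Membership.Propositional using (_∈_)
open import Data.List using (List; []; _∷_; _++_; map; length; filterᵇ; allFin)
open import Data.Vec using (Vec; lookup; _∷ʳ_)
import Data.Vec as V
open import Data.Product using (_×_; _,_; proj₁; proj₂)

-- Circuits.  Nodes are numbered 0,1,...,N-1 in a topological order:
-- a gate at position k only reads nodes with index < k.

data Label (n m : ℕ) : Set where
  var   : Fin n → Label n m
  guess : Fin m → Label n m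
  const : Bool → Label n m

data Node (n m k : ℕ) : Set where
  input : Label n m → Node n m k
  AND   : Fin k → Fin k → Node n m k
  OR    : Fin k → Fin k → Node n m k
  NOT   : Fin k → Node n m k

data Nodes (n m : ℕ) : ℕ → Set where
  []  : Nodes n m zero
  _▷_ : ∀ {k} → Nodes n m k → Node n m k → Nodes n m (suc k)

record Circuit (n m : ℕ) : Set where
  field
    N      : ℕ
    nodes  : Nodes n m N
    output : Fin N
open Circuit public

labelVal : ∀ {n m} → Label n m → (Fin n → Bool) → (Fin m → Bool) → Bool
labelVal (var i)   x y = x i
labelVal (guess j) x y = y j
labelVal (const b) x y = b

nodeVal : ∀ {n m k} → Node n m k → (Fin n → Bool) → (Fin m → Bool) → Vec Bool k → Bool
nodeVal (input l) x y v = labelVal l x y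
nodeVal (AND a b) x y v = lookup v a ∧ lookup v b
nodeVal (OR a b)  x y v = lookup v a ∨ lookup v b
nodeVal (NOT a)   x y v = not (lookup v a)

values : ∀ {n m k} → Nodes n m k → (Fin n → Bool) → (Fin m → Bool) → Vec Bool k
values [] x y = V.[]
values (C ▷ g) x y = let v = values C x y in v ∷ʳ nodeVal g x y v

eval : ∀ {n m} → Circuit n m → (Fin n → Bool) → (Fin m → Bool) → Bool
eval C x y = lookup (values (nodes C) x y) (output C)

-- Nondeterministic semantics: C computes f with f x = 1 iff ∃ y, C(x,y) = 1.
-- (For a deterministic circuit, m = 0.)
noGuess : Fin 0 → Bool
noGuess ()

isGate : ∀ {n m k} → Node n m k → Bool
isGate (input _) = false
isGate _         = true

gateFlags : ∀ {n m k} → Nodes n m k → Vec Bool k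
gateFlags [] = V.[]
gateFlags (C ▷ g) = gateFlags C ∷ʳ isGate g

-- edges (child , parent) of the DAG (with multiplicity)
nodeEdges : ∀ {n m k} → Node n m k → List (Fin (suc k) × Fin (suc k))
nodeEdges {k = k} (input _) = []
nodeEdges {k = k} (AND a b) = (inject₁ a , fromℕ k) ∷ (inject₁ b , fromℕ k) ∷ []
nodeEdges {k = k} (OR a b)  = (inject₁ a , fromℕ k) ∷ (inject₁ b , fromℕ k) ∷ []
nodeEdges {k = k} (NOT a)   = (inject₁ a , fromℕ k) ∷ []

edges : ∀ {n m k} → Nodes n m k → List (Fin k × Fin k)
edges [] = []
edges (C ▷ g) = map (λ e → inject₁ (proj₁ e) , inject₁ (proj₂ e)) (edges C) ++ nodeEdges g

nodeLabels : ∀ {n m k} → Nodes n m k → List (Label n m)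
nodeLabels [] = []
nodeLabels (C ▷ input l) = nodeLabels C ++ (l ∷ [])
nodeLabels (C ▷ _) = nodeLabels C

isGuess : ∀ {n m} → Fin m → Label n m → Bool
isGuess j (guess j') = ⌊ j ≟ j' ⌋
isGuess j _ = false

GuessOnce : ∀ {n m} → Circuit n m → Set
GuessOnce {m = m} C = (j : Fin m) → length (filterᵇ (isGuess j) (nodeLabels (nodes C))) ≤ 1

size : ∀ {n m} → Circuit n m → ℕ
size C = length (filterᵇ (λ i → lookup (gateFlags (nodes C)) i) (allFin (N C)))

Layering : ∀ {n m} → Circuit n m → Set
Layering C = Fin (N C) → ℕ

ValidLayering : ∀ {n m} (C : Circuit n m) → Layering C → Set
ValidLayering C L = ∀ u v → (u , v) ∈ edges (nodes C) → L u < L v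

-- number of gates in layer ℓ after subdividing every edge that jumps over
-- layers by COPY gates: the gates placed at layer ℓ, plus one COPY gate
-- for each edge (u , v) with L u < ℓ < L v.
layerWidth : ∀ {n m} (C : Circuit n m) → Layering C → ℕ → ℕ
layerWidth C L ℓ =
  length (filterᵇ (λ i → lookup (gateFlags (nodes C)) i ∧ (L i ≡ᵇ ℓ)) (allFin (N C)))
  + length (filterᵇ (λ e → (L (proj₁ e) <ᵇ ℓ) ∧ (ℓ <ᵇ L (proj₂ e))) (edges (nodes C)))

WidthAtMost : ∀ {n m} (C : Circuit n m) → Layering C → ℕ → Set
WidthAtMost C L w = (ℓ : ℕ) → layerWidth C L ℓ ≤ w

-- logarithm used in the O(log s) bounds (⌈log₂ (s+2)⌉ ≥ 1)
lg : ℕ → ℕ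
lg s = ⌈log₂ (s + 2) ⌉

-- Cut a circuit of width w at the layers that contain gates.  At a cut t
-- only the gates of layer t, the tails of the edges jumping over t and,
-- once computed, the output have to be remembered: at most w + 1 values.
-- The circuit accepts x iff some assignment to all its nodes is locally
-- correct from the first cut to the last one (as each guess input labels a
-- single node, such an assignment determines the guesses), and, as in
-- Savitch's theorem, an assignment across 2^(d+1) consecutive cuts exists iff
-- for some values at the middle cut there is one across each half.  Unfolded
-- to depth d = ⌈log₂ (s + 2)⌉ this is a formula in x of size 2^O((w + d) d):
-- every level is a disjunction over the 2^(w+1) values at the middle cut,
-- every leaf one over the 2^O(w) assignments to the O(w) nodes between two
-- adjacent cuts.  Written out in post-order, the formula is a circuit whose
-- node indices are layers crossed by fewer wires than its Sethi–Ullman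
-- register number, which grows by 2 per level: width O(log s).

module Submission where

open import Defs
open import Data.Nat using (ℕ; zero; suc; _+_; _*_; _^_; _∸_; _≤_; _<_; _≤′_; ≤′-refl; ≤′-step; _<ᵇ_; _≡ᵇ_; _⊔_; z≤n; s≤s; _≤?_; _<?_; ⌊_/2⌋; ⌈_/2⌉)
open import Data.Nat.Logarithm using (⌈log₂_⌉; ⌈log₂⌉-mono-≤; ⌈log₂⌈n/2⌉⌉≡⌈log₂n⌉∸1)
open import Data.Nat.Induction using (<-rec)
open import Data.Nat.Tactic.RingSolver using (solve-∀)
open import Data.Nat.Properties hiding (_≟_)
open import Data.Bool using (Bool; true; false; _∧_; _∨_; not; T; T?; if_then_else_)
open import Data.Bool.Properties using (∧-conicalˡ; ∧-conicalʳ; ∧-zeroʳ; ∨-zeroʳ; T-∧; T-≡)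
open import Data.Unit using (⊤; tt)
open import Data.Empty using (⊥-elim)
open import Data.List using (List; []; _∷_; _++_; map; length; filterᵇ; allFin; tabulate; concatMap)
open import Data.List.Properties using (length-filter; filter-++; map-++; map-∘; map-cong; ++-assoc; length-map; length-++; length-tabulate; map-tabulate)
open import Data.List.Membership.Propositional using (_∈_)
open import Data.List.Membership.Propositional.Properties using (∈-++⁻; ∈-++⁺ˡ; ∈-++⁺ʳ; ∈-map⁻; ∈-map⁺; ∈-filter⁻; ∈-filter⁺; ∈-allFin; ∈-concat⁺′; ∈-concat⁻′)
open import Data.List.Relation.Unary.Any using (here; there)
import Data.List.Relation.Unary.All as All
open import Data.List.Relation.Unary.Linked using (Linked; [-]; _∷_)
open import Data.List.Extrema.Nat using (max; xs≤max)
open import Data.List.Relation.Binary.Permutation.Propositional using (↭-sym)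
open import Data.List.Relation.Binary.Permutation.Propositional.Properties using (∈-resp-↭; ↭-length)
import Data.List.Sort
open import Data.Vec using (Vec; lookup; _∷ʳ_)
import Data.Vec as Vec
import Data.Bool
open import Data.Fin using (Fin; toℕ; fromℕ; inject₁; inject≤)
open import Data.Fin.Properties using (toℕ-fromℕ; toℕ-inject₁; toℕ-inject≤; toℕ<n; inject≤-refl; inject≤-idempotent)
open import Data.Product using (Σ; _×_; _,_; proj₁; proj₂)
open import Data.Sum using (_⊎_; inj₁; inj₂)
import Data.Sum as Sum
open import Relation.Binary.PropositionalEquality
open import Relation.Nullary using (Dec; yes; no; does)
open import Relation.Binary.Definitions using (DecidableEquality)
open import Function using (_∘_)
open import Function.Bundles using (_⇔_; mk⇔; Equivalence)

T-∧⁻ : ∀ {a b} → T (a ∧ b) → T a × T b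
T-∧⁻ = Equivalence.to T-∧

T-∧⁺ : ∀ {a b} → T a → T b → T (a ∧ b)
T-∧⁺ Ta Tb = Equivalence.from T-∧ (Ta , Tb)

true-or-false : ∀ b → b ≡ true ⊎ b ≡ false
true-or-false true  = inj₁ refl
true-or-false false = inj₂ refl

false≢true : false ≢ true
false≢true ()

T⇒≡true : ∀ {b} → T b → b ≡ true
T⇒≡true = Equivalence.to T-≡

≡true⇒T : ∀ {b} → b ≡ true → T b
≡true⇒T = Equivalence.from T-≡

<ᵇ-true : ∀ {a b} → a < b → (a <ᵇ b) ≡ true
<ᵇ-true a<b = T⇒≡true (<⇒<ᵇ a<b)

<ᵇ-true⁻ : ∀ {a b} → (a <ᵇ b) ≡ true → a < b
<ᵇ-true⁻ {a} {b} eq = <ᵇ⇒< a b (≡true⇒T eq)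

<ᵇ-false : ∀ {a b} → b ≤ a → (a <ᵇ b) ≡ false
<ᵇ-false {a} {b} b≤a with a <ᵇ b in eq
... | false = refl
... | true  = ⊥-elim (<⇒≱ (<ᵇ-true⁻ eq) b≤a)

<ᵇ-false⁻ : ∀ {a b} → (a <ᵇ b) ≡ false → b ≤ a
<ᵇ-false⁻ {a} {b} eq with a <? b
... | yes a<b = ⊥-elim (subst T eq (<⇒<ᵇ a<b))
... | no  a≮b = ≮⇒≥ a≮b

does-sound : ∀ {a b : Bool} → does (a Data.Bool.≟ b) ≡ true → a ≡ b
does-sound {a} {b} eq with a Data.Bool.≟ b
... | yes a≡b = a≡b

does-complete : ∀ {a b : Bool} → a ≡ b → does (a Data.Bool.≟ b) ≡ true
does-complete {a} refl with a Data.Bool.≟ a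
... | yes _  = refl
... | no a≢a = ⊥-elim (a≢a refl)

module _ {A : Set} where

  length-filterᵇ-++ : (p : A → Bool) (xs ys : List A) →
    length (filterᵇ p (xs ++ ys)) ≡ length (filterᵇ p xs) + length (filterᵇ p ys)
  length-filterᵇ-++ p xs ys = trans (cong length (filter-++ (T? ∘ p) xs ys)) (length-++ (filterᵇ p xs))

  length-filterᵇ-mono : (p q : A → Bool) → (∀ x → T (p x) → T (q x)) → (xs : List A) →
    length (filterᵇ p xs) ≤ length (filterᵇ q xs)
  length-filterᵇ-mono p q p⇒q [] = z≤n
  length-filterᵇ-mono p q p⇒q (x ∷ xs) with p x in px | q x in qx
  ... | true  | true  = s≤s (length-filterᵇ-mono p q p⇒q xs)
  ... | false | true  = m≤n⇒m≤1+n (length-filterᵇ-mono p q p⇒q xs)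
  ... | false | false = length-filterᵇ-mono p q p⇒q xs
  ... | true  | false = ⊥-elim (subst T qx (p⇒q x (subst T (sym px) tt)))

  length-filterᵇ-none : (p : A → Bool) (xs : List A) → (∀ x → p x ≡ false) → length (filterᵇ p xs) ≡ 0
  length-filterᵇ-none p []       none = refl
  length-filterᵇ-none p (x ∷ xs) none rewrite none x = length-filterᵇ-none p xs none

  length-filterᵇ-map : ∀ {B : Set} (p : A → Bool) (f : B → A) (xs : List B) →
    length (filterᵇ p (map f xs)) ≡ length (filterᵇ (p ∘ f) xs)
  length-filterᵇ-map p f [] = refl
  length-filterᵇ-map p f (x ∷ xs) with p (f x)
  ... | true  = cong suc (length-filterᵇ-map p f xs)
  ... | false = length-filterᵇ-map p f xs

tabulate-suc : ∀ N → tabulate {n = N} Fin.suc ≡ map Fin.suc (allFin N)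
tabulate-suc N = sym (map-tabulate {n = N} (λ i → i) Fin.suc)

length-filter-toℕ≡ᵇ≤1 : ∀ N ℓ → length (filterᵇ (λ (i : Fin N) → toℕ i ≡ᵇ ℓ) (allFin N)) ≤ 1
length-filter-toℕ≡ᵇ≤1 zero    ℓ = z≤n
length-filter-toℕ≡ᵇ≤1 (suc N) ℓ rewrite tabulate-suc N with ℓ
... | zero  = s≤s (≤-reflexive (trans (length-filterᵇ-map _ Fin.suc (allFin N))
                                       (length-filterᵇ-none _ (allFin N) (λ _ → refl))))
... | suc ℓ = ≤-trans (≤-reflexive (length-filterᵇ-map _ Fin.suc (allFin N))) (length-filter-toℕ≡ᵇ≤1 N ℓ)

-- Formulas

data BinOp : Set where
  and or : BinOp

apply : BinOp → Bool → Bool → Bool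
apply and = _∧_
apply or  = _∨_

gate : ∀ {n m k} → BinOp → Fin k → Fin k → Node n m k
gate and = AND
gate or  = OR

data Formula (n : ℕ) : Set where
  lit : Fin n → Formula n
  cst : Bool → Formula n
  neg : Formula n → Formula n
  bin : BinOp → Formula n → Formula n → Formula n

module _ {n : ℕ} where

  ⟦_⟧ : Formula n → (Fin n → Bool) → Bool
  ⟦ lit i ⟧     x = x i
  ⟦ cst b ⟧     x = b
  ⟦ neg f ⟧     x = not (⟦ f ⟧ x)
  ⟦ bin o f g ⟧ x = apply o (⟦ f ⟧ x) (⟦ g ⟧ x)

  -- Position of the root when the nodes of f are appended, in post-order,
  -- to a circuit with k nodes.
  rootAt : Formula n → ℕ → ℕ
  rootAt (lit _)     k = k
  rootAt (cst _)     k = k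
  rootAt (neg f)     k = suc (rootAt f k)
  rootAt (bin _ f g) k = suc (rootAt g (suc (rootAt f k)))

  nodeCount : Formula n → ℕ
  nodeCount f = suc (rootAt f 0)

  -- Sethi–Ullman number: evaluating f first and holding its value while g
  -- is evaluated, the post-order circuit for bin o f g never holds more
  -- than max (registers f) (1 + registers g) values at once.
  registers : Formula n → ℕ
  registers (lit _)     = 1
  registers (cst _)     = 1
  registers (neg f)     = registers f
  registers (bin _ f g) = registers f ⊔ suc (registers g)

  rootAt-+ : ∀ f k → rootAt f k ≡ rootAt f 0 + k
  rootAt-+ (lit _)     k = refl
  rootAt-+ (cst _)     k = refl
  rootAt-+ (neg f)     k = cong suc (rootAt-+ f k)
  rootAt-+ (bin _ f g) k = cong suc (begin
      rootAt g (suc (rootAt f k))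
    ≡⟨ rootAt-+ g _ ⟩
      rootAt g 0 + suc (rootAt f k)
    ≡⟨ cong (λ z → rootAt g 0 + suc z) (rootAt-+ f k) ⟩
      rootAt g 0 + suc (rootAt f 0 + k)
    ≡⟨ sym (+-assoc (rootAt g 0) (suc (rootAt f 0)) k) ⟩
      rootAt g 0 + suc (rootAt f 0) + k
    ≡⟨ cong (_+ k) (sym (rootAt-+ g (suc (rootAt f 0)))) ⟩
      rootAt g (suc (rootAt f 0)) + k ∎)
    where open ≡-Reasoning

  k≤rootAt : ∀ f k → k ≤ rootAt f k
  k≤rootAt f k = subst (k ≤_) (sym (rootAt-+ f k)) (m≤n+m k (rootAt f 0))

  rootAt-left< : ∀ o f g k → rootAt f k < rootAt (bin o f g) k
  rootAt-left< o f g k = s≤s (≤-trans (n≤1+n _) (k≤rootAt g _))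

  nodeCount-bin : ∀ o f g → nodeCount (bin o f g) ≡ suc (nodeCount f + nodeCount g)
  nodeCount-bin o f g = cong (suc ∘ suc) (begin
      rootAt g (suc (rootAt f 0))  ≡⟨ rootAt-+ g _ ⟩
      rootAt g 0 + suc (rootAt f 0) ≡⟨ +-comm (rootAt g 0) _ ⟩
      suc (rootAt f 0 + rootAt g 0) ≡⟨ sym (+-suc (rootAt f 0) _) ⟩
      rootAt f 0 + nodeCount g      ∎)
    where open ≡-Reasoning

-- Compiling a formula into a circuit

module _ {n : ℕ} where

  append : ∀ {k} → Nodes n 0 k → (f : Formula n) → Nodes n 0 (suc (rootAt f k))
  append C (lit i)     = C ▷ input (var i)
  append C (cst b)     = C ▷ input (const b)
  append C (neg f)     = append C f ▷ NOT (fromℕ _)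
  append {k} C (bin o f g) =
    append (append C f) g ▷ gate o (inject≤ (fromℕ (rootAt f k)) (rootAt-left< o f g k)) (fromℕ _)

  compile : Formula n → Circuit n 0
  compile f = record { N = nodeCount f ; nodes = append [] f ; output = fromℕ _ }

lookup-∷ʳ-fromℕ : ∀ {A : Set} {k} (v : Vec A k) y → lookup (v ∷ʳ y) (fromℕ k) ≡ y
lookup-∷ʳ-fromℕ Vec.[]       y = refl
lookup-∷ʳ-fromℕ (x Vec.∷ v) y = lookup-∷ʳ-fromℕ v y

lookup-∷ʳ-inject≤ : ∀ {A : Set} {j k} (v : Vec A k) y (i : Fin j) (j≤k : j ≤ k) .(j≤1+k : j ≤ suc k) →
  lookup (v ∷ʳ y) (inject≤ i j≤1+k) ≡ lookup v (inject≤ i j≤k)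
lookup-∷ʳ-inject≤ (x Vec.∷ v) y Fin.zero    (s≤s j≤k) _ = refl
lookup-∷ʳ-inject≤ (x Vec.∷ v) y (Fin.suc i) (s≤s j≤k) _ = lookup-∷ʳ-inject≤ v y i j≤k _

module _ {n : ℕ} (x : Fin n → Bool) where

  private
    val : ∀ {k} → Nodes n 0 k → Vec Bool k
    val C = values C x noGuess

  values-append-prefix : ∀ {j k} (C : Nodes n 0 k) f (i : Fin j) (j≤k : j ≤ k) .(j≤ : j ≤ suc (rootAt f k)) →
    lookup (val (append C f)) (inject≤ i j≤) ≡ lookup (val C) (inject≤ i j≤k)
  values-append-prefix C (lit _) i j≤k _ = lookup-∷ʳ-inject≤ (val C) _ i j≤k _
  values-append-prefix C (cst _) i j≤k _ = lookup-∷ʳ-inject≤ (val C) _ i j≤k _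
  values-append-prefix {j} {k} C (neg f) i j≤k _ = begin
      lookup (val (append C (neg f))) (inject≤ i _)
    ≡⟨ lookup-∷ʳ-inject≤ (val (append C f)) _ i j≤ _ ⟩
      lookup (val (append C f)) (inject≤ i j≤)
    ≡⟨ values-append-prefix C f i j≤k j≤ ⟩
      lookup (val C) (inject≤ i j≤k) ∎
    where
    open ≡-Reasoning
    j≤ : j ≤ suc (rootAt f k)
    j≤ = ≤-trans j≤k (≤-trans (k≤rootAt f k) (n≤1+n _))
  values-append-prefix {j} {k} C (bin o f g) i j≤k _ = begin
      lookup (val (append C (bin o f g))) (inject≤ i _)
    ≡⟨ lookup-∷ʳ-inject≤ (val (append (append C f) g)) _ i j≤′ _ ⟩
      lookup (val (append (append C f) g)) (inject≤ i j≤′)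
    ≡⟨ sym (cong (lookup (val (append (append C f) g))) (inject≤-idempotent i j≤ (rootAt-left< o f g k) j≤′)) ⟩
      lookup (val (append (append C f) g)) (inject≤ (inject≤ i j≤) (rootAt-left< o f g k))
    ≡⟨ values-append-prefix (append C f) g (inject≤ i j≤) ≤-refl _ ⟩
      lookup (val (append C f)) (inject≤ (inject≤ i j≤) ≤-refl)
    ≡⟨ cong (lookup (val (append C f))) (inject≤-refl (inject≤ i j≤) _) ⟩
      lookup (val (append C f)) (inject≤ i j≤)
    ≡⟨ values-append-prefix C f i j≤k j≤ ⟩
      lookup (val C) (inject≤ i j≤k) ∎
    where
    open ≡-Reasoning
    j≤ : j ≤ suc (rootAt f k)
    j≤ = ≤-trans j≤k (≤-trans (k≤rootAt f k) (n≤1+n _))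
    j≤′ : j ≤ rootAt (bin o f g) k
    j≤′ = ≤-trans j≤ (rootAt-left< o f g k)

  values-append-root : ∀ {k} (C : Nodes n 0 k) f → lookup (val (append C f)) (fromℕ (rootAt f k)) ≡ ⟦ f ⟧ x
  values-append-root C (lit _) = lookup-∷ʳ-fromℕ (val C) _
  values-append-root C (cst _) = lookup-∷ʳ-fromℕ (val C) _
  values-append-root C (neg f) =
    trans (lookup-∷ʳ-fromℕ (val (append C f)) _) (cong not (values-append-root C f))
  values-append-root {k} C (bin o f g) = begin
      lookup (val (append C (bin o f g))) (fromℕ _)
    ≡⟨ lookup-∷ʳ-fromℕ (val (append (append C f) g)) _ ⟩
      nodeVal (gate o (inject≤ (fromℕ (rootAt f k)) _) (fromℕ _)) x noGuess (val (append (append C f) g))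
    ≡⟨ nodeVal-gate o ⟩
      apply o (lookup (val (append (append C f) g)) (inject≤ (fromℕ (rootAt f k)) _))
              (lookup (val (append (append C f) g)) (fromℕ _))
    ≡⟨ cong₂ (apply o) left (values-append-root (append C f) g) ⟩
      apply o (⟦ f ⟧ x) (⟦ g ⟧ x) ∎
    where
    open ≡-Reasoning
    nodeVal-gate : ∀ {k} o {a b : Fin k} {v} → nodeVal {m = 0} (gate o a b) x noGuess v ≡ apply o (lookup v a) (lookup v b)
    nodeVal-gate and = refl
    nodeVal-gate or  = refl
    left : lookup (val (append (append C f) g)) (inject≤ (fromℕ (rootAt f k)) _) ≡ ⟦ f ⟧ x
    left = begin
        lookup (val (append (append C f) g)) (inject≤ (fromℕ (rootAt f k)) _)
      ≡⟨ values-append-prefix (append C f) g (fromℕ (rootAt f k)) ≤-refl _ ⟩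
        lookup (val (append C f)) (inject≤ (fromℕ (rootAt f k)) ≤-refl)
      ≡⟨ cong (lookup (val (append C f))) (inject≤-refl (fromℕ (rootAt f k)) _) ⟩
        lookup (val (append C f)) (fromℕ (rootAt f k))
      ≡⟨ values-append-root C f ⟩
        ⟦ f ⟧ x ∎

compile-eval : ∀ {n} (f : Formula n) x → eval (compile f) x noGuess ≡ ⟦ f ⟧ x
compile-eval f x = values-append-root x [] f

inject₁² : ∀ {k} → Fin k × Fin k → Fin (suc k) × Fin (suc k)
inject₁² e = inject₁ (proj₁ e) , inject₁ (proj₂ e)

toℕ² : ∀ {k} → Fin k × Fin k → ℕ × ℕ
toℕ² (u , v) = toℕ u , toℕ v

module _ {n m : ℕ} where

  nodeEdges-forward : ∀ {k} (g : Node n m k) {u v} → (u , v) ∈ nodeEdges g → toℕ u < toℕ v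
  nodeEdges-forward {k} (AND a b) (here refl)         rewrite toℕ-inject₁ a | toℕ-fromℕ k = toℕ<n a
  nodeEdges-forward {k} (AND a b) (there (here refl)) rewrite toℕ-inject₁ b | toℕ-fromℕ k = toℕ<n b
  nodeEdges-forward {k} (OR a b)  (here refl)         rewrite toℕ-inject₁ a | toℕ-fromℕ k = toℕ<n a
  nodeEdges-forward {k} (OR a b)  (there (here refl)) rewrite toℕ-inject₁ b | toℕ-fromℕ k = toℕ<n b
  nodeEdges-forward {k} (NOT a)   (here refl)         rewrite toℕ-inject₁ a | toℕ-fromℕ k = toℕ<n a

  edges-forward : ∀ {k} (C : Nodes n m k) {u v} → (u , v) ∈ edges C → toℕ u < toℕ v
  edges-forward (C ▷ g) e∈ with ∈-++⁻ (map inject₁² (edges C)) e∈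
  ... | inj₂ e∈g = nodeEdges-forward g e∈g
  ... | inj₁ e∈C with ∈-map⁻ inject₁² e∈C
  ... | (u , v) , uv∈ , refl rewrite toℕ-inject₁ u | toℕ-inject₁ v = edges-forward C uv∈

  edgesℕ : ∀ {k} → Nodes n m k → List (ℕ × ℕ)
  edgesℕ C = map toℕ² (edges C)

  edgesℕ-▷ : ∀ {k} (C : Nodes n m k) g → edgesℕ (C ▷ g) ≡ edgesℕ C ++ map toℕ² (nodeEdges g)
  edgesℕ-▷ C g = begin
      map toℕ² (map inject₁² (edges C) ++ nodeEdges g)
    ≡⟨ map-++ toℕ² (map inject₁² (edges C)) (nodeEdges g) ⟩
      map toℕ² (map inject₁² (edges C)) ++ map toℕ² (nodeEdges g)
    ≡⟨ cong (_++ map toℕ² (nodeEdges g)) (trans (sym (map-∘ (edges C))) (map-cong toℕ²-inject₁² (edges C))) ⟩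
      edgesℕ C ++ map toℕ² (nodeEdges g) ∎
    where
    open ≡-Reasoning
    toℕ²-inject₁² : ∀ {k} (e : Fin k × Fin k) → toℕ² (inject₁² e) ≡ toℕ² e
    toℕ²-inject₁² (u , v) = cong₂ _,_ (toℕ-inject₁ u) (toℕ-inject₁ v)

  nodeEdgesℕ-NOT : ∀ {k} (a : Fin k) → map toℕ² (nodeEdges {n} {m} (NOT a)) ≡ (toℕ a , k) ∷ []
  nodeEdgesℕ-NOT {k} a rewrite toℕ-inject₁ a | toℕ-fromℕ k = refl

  nodeEdgesℕ-gate : ∀ {k} o (a b : Fin k) → map toℕ² (nodeEdges {n} {m} (gate o a b)) ≡ (toℕ a , k) ∷ (toℕ b , k) ∷ []
  nodeEdgesℕ-gate {k} and a b rewrite toℕ-inject₁ a | toℕ-inject₁ b | toℕ-fromℕ k = refl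
  nodeEdgesℕ-gate {k} or  a b rewrite toℕ-inject₁ a | toℕ-inject₁ b | toℕ-fromℕ k = refl

crosses : ℕ → ℕ × ℕ → Bool
crosses ℓ e = (proj₁ e <ᵇ ℓ) ∧ (ℓ <ᵇ proj₂ e)

#crossing : ℕ → List (ℕ × ℕ) → ℕ
#crossing ℓ E = length (filterᵇ (crosses ℓ) E)

crosses-outside : ∀ {ℓ a b} → ℓ ≤ a ⊎ b ≤ ℓ → crosses ℓ (a , b) ≡ false
crosses-outside {ℓ} {a} (inj₁ ℓ≤a) rewrite <ᵇ-false {a} {ℓ} ℓ≤a = refl
crosses-outside {ℓ} {a} {b} (inj₂ b≤ℓ) rewrite <ᵇ-false {ℓ} {b} b≤ℓ = ∧-zeroʳ (a <ᵇ ℓ)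

crosses-adjacent : ∀ ℓ r → crosses ℓ (r , suc r) ≡ false
crosses-adjacent ℓ r with ℓ ≤? r
... | yes ℓ≤r = crosses-outside {ℓ} {r} {suc r} (inj₁ ℓ≤r)
... | no  ℓ≰r = crosses-outside {ℓ} {r} {suc r} (inj₂ (≰⇒> ℓ≰r))

#crossing-none : ∀ ℓ E → (∀ {e} → e ∈ E → crosses ℓ e ≡ false) → #crossing ℓ E ≡ 0
#crossing-none ℓ []      none = refl
#crossing-none ℓ (e ∷ E) none rewrite none (here refl) = #crossing-none ℓ E (none ∘ there)

#crossing-++ : ∀ ℓ E F → #crossing ℓ (E ++ F) ≡ #crossing ℓ E + #crossing ℓ F
#crossing-++ ℓ = length-filterᵇ-++ (crosses ℓ)

#crossing-fork≤1 : ∀ ℓ a r → #crossing ℓ ((a , suc r) ∷ (r , suc r) ∷ []) ≤ 1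
#crossing-fork≤1 ℓ a r with crosses ℓ (a , suc r)
... | true  rewrite crosses-adjacent ℓ r = ≤-refl
... | false rewrite crosses-adjacent ℓ r = z≤n

#crossing-fork≡0 : ∀ {ℓ a} r → ℓ ≤ a → #crossing ℓ ((a , suc r) ∷ (r , suc r) ∷ []) ≡ 0
#crossing-fork≡0 {ℓ} {a} r ℓ≤a rewrite crosses-outside {ℓ} {a} {suc r} (inj₁ ℓ≤a) | crosses-adjacent ℓ r = refl

module _ {n : ℕ} where

  formulaEdges : Formula n → ℕ → List (ℕ × ℕ)
  formulaEdges (lit _)     k = []
  formulaEdges (cst _)     k = []
  formulaEdges (neg f)     k = formulaEdges f k ++ (rootAt f k , suc (rootAt f k)) ∷ []
  formulaEdges (bin o f g) k =
    (formulaEdges f k ++ formulaEdges g (suc (rootAt f k)))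
    ++ (rootAt f k , rootAt (bin o f g) k) ∷ (rootAt g (suc (rootAt f k)) , rootAt (bin o f g) k) ∷ []

  edgesℕ-append : ∀ {k} (C : Nodes n 0 k) f → edgesℕ (append C f) ≡ edgesℕ C ++ formulaEdges f k
  edgesℕ-append C (lit i) = edgesℕ-▷ C (input (var i))
  edgesℕ-append C (cst b) = edgesℕ-▷ C (input (const b))
  edgesℕ-append {k} C (neg f) = begin
      edgesℕ (append C f ▷ NOT (fromℕ (rootAt f k)))
    ≡⟨ edgesℕ-▷ (append C f) (NOT (fromℕ (rootAt f k))) ⟩
      edgesℕ (append C f) ++ map toℕ² (nodeEdges {n} {0} (NOT (fromℕ (rootAt f k))))
    ≡⟨ cong₂ _++_ (edgesℕ-append C f) (trans (nodeEdgesℕ-NOT {n} {0} (fromℕ (rootAt f k)))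
                                              (cong (λ z → (z , suc (rootAt f k)) ∷ []) (toℕ-fromℕ _))) ⟩
      (edgesℕ C ++ formulaEdges f k) ++ (rootAt f k , suc (rootAt f k)) ∷ []
    ≡⟨ ++-assoc (edgesℕ C) _ _ ⟩
      edgesℕ C ++ formulaEdges (neg f) k ∎
    where open ≡-Reasoning
  edgesℕ-append {k} C (bin o f g) = begin
      edgesℕ (append (append C f) g ▷ gate o a b)
    ≡⟨ edgesℕ-▷ (append (append C f) g) (gate o a b) ⟩
      edgesℕ (append (append C f) g) ++ map toℕ² (nodeEdges {n} {0} (gate o a b))
    ≡⟨ cong₂ _++_ (edgesℕ-append (append C f) g)
         (trans (nodeEdgesℕ-gate {n} {0} o a b) (cong₂ (λ u v → (u , rootAt (bin o f g) k) ∷ (v , rootAt (bin o f g) k) ∷ []) toℕa toℕb)) ⟩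
      (edgesℕ (append C f) ++ formulaEdges g (suc (rootAt f k))) ++ rootEdges
    ≡⟨ cong (λ z → (z ++ formulaEdges g (suc (rootAt f k))) ++ rootEdges) (edgesℕ-append C f) ⟩
      ((edgesℕ C ++ formulaEdges f k) ++ formulaEdges g (suc (rootAt f k))) ++ rootEdges
    ≡⟨ cong (_++ rootEdges) (++-assoc (edgesℕ C) _ _) ⟩
      (edgesℕ C ++ (formulaEdges f k ++ formulaEdges g (suc (rootAt f k)))) ++ rootEdges
    ≡⟨ ++-assoc (edgesℕ C) _ _ ⟩
      edgesℕ C ++ formulaEdges (bin o f g) k ∎
    where
    open ≡-Reasoning
    a b : Fin (rootAt (bin o f g) k)
    a = inject≤ (fromℕ (rootAt f k)) (rootAt-left< o f g k)
    b = fromℕ (rootAt g (suc (rootAt f k)))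
    toℕa : toℕ a ≡ rootAt f k
    toℕa = trans (toℕ-inject≤ _ _) (toℕ-fromℕ _)
    toℕb : toℕ b ≡ rootAt g (suc (rootAt f k))
    toℕb = toℕ-fromℕ _
    rootEdges : List (ℕ × ℕ)
    rootEdges = (rootAt f k , rootAt (bin o f g) k) ∷ (rootAt g (suc (rootAt f k)) , rootAt (bin o f g) k) ∷ []

  formulaEdges-bounds : ∀ f k {e} → e ∈ formulaEdges f k → k ≤ proj₁ e × proj₂ e ≤ rootAt f k
  formulaEdges-bounds (neg f) k e∈ with ∈-++⁻ (formulaEdges f k) e∈
  ... | inj₁ e∈f = let (k≤ , ≤r) = formulaEdges-bounds f k e∈f in k≤ , m≤n⇒m≤1+n ≤r
  ... | inj₂ (here refl) = k≤rootAt f k , ≤-refl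
  formulaEdges-bounds (bin o f g) k e∈ with ∈-++⁻ (formulaEdges f k ++ formulaEdges g (suc (rootAt f k))) e∈
  ... | inj₂ (here refl) = k≤rootAt f k , ≤-refl
  ... | inj₂ (there (here refl)) = ≤-trans (k≤rootAt f k) (≤-trans (n≤1+n _) (k≤rootAt g _)) , ≤-refl
  ... | inj₁ e∈fg with ∈-++⁻ (formulaEdges f k) e∈fg
  ... | inj₁ e∈f = let (k≤ , ≤r) = formulaEdges-bounds f k e∈f in k≤ , ≤-trans ≤r (<⇒≤ (rootAt-left< o f g k))
  ... | inj₂ e∈g = let (k≤ , ≤r) = formulaEdges-bounds g _ e∈g in
    ≤-trans (≤-trans (k≤rootAt f k) (n≤1+n _)) k≤ , m≤n⇒m≤1+n ≤r

  #crossing-outside : ∀ f k ℓ → ℓ ≤ k ⊎ rootAt f k ≤ ℓ → #crossing ℓ (formulaEdges f k) ≡ 0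
  #crossing-outside f k ℓ out = #crossing-none ℓ (formulaEdges f k) λ e∈ →
    let (k≤ , ≤r) = formulaEdges-bounds f k e∈ in
    crosses-outside (Sum.map (λ ℓ≤k → ≤-trans ℓ≤k k≤) (≤-trans ≤r) out)

  #crossing-bin : ∀ o f g k ℓ → let rg = rootAt g (suc (rootAt f k)) in
    #crossing ℓ (formulaEdges (bin o f g) k)
      ≡ #crossing ℓ (formulaEdges f k) + #crossing ℓ (formulaEdges g (suc (rootAt f k)))
        + #crossing ℓ ((rootAt f k , suc rg) ∷ (rg , suc rg) ∷ [])
  #crossing-bin o f g k ℓ =
    trans (#crossing-++ ℓ (formulaEdges f k ++ Eg) Er) (cong (_+ #crossing ℓ Er) (#crossing-++ ℓ (formulaEdges f k) Eg))
    where
    rg : ℕ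
    rg = rootAt g (suc (rootAt f k))
    Eg Er : List (ℕ × ℕ)
    Eg = formulaEdges g (suc (rootAt f k))
    Er = (rootAt f k , suc rg) ∷ (rg , suc rg) ∷ []

  #crossing<registers : ∀ f k ℓ → #crossing ℓ (formulaEdges f k) < registers f
  #crossing<registers (lit _) k ℓ = s≤s z≤n
  #crossing<registers (cst _) k ℓ = s≤s z≤n
  #crossing<registers (neg f) k ℓ
    rewrite #crossing-++ ℓ (formulaEdges f k) ((rootAt f k , suc (rootAt f k)) ∷ [])
          | crosses-adjacent ℓ (rootAt f k)
          | +-identityʳ (#crossing ℓ (formulaEdges f k)) = #crossing<registers f k ℓ
  #crossing<registers (bin o f g) k ℓ =
    subst (_< registers (bin o f g)) (sym (#crossing-bin o f g k ℓ)) (bound (ℓ ≤? rf))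
    where
    rf rg #f #g #root : ℕ
    rf = rootAt f k
    rg = rootAt g (suc rf)
    #f = #crossing ℓ (formulaEdges f k)
    #g = #crossing ℓ (formulaEdges g (suc rf))
    #root = #crossing ℓ ((rf , suc rg) ∷ (rg , suc rg) ∷ [])
    -- Up to the root of f only edges of f cross ℓ; beyond it, edges of g
    -- and the one edge from the root of f, held while g is evaluated.
    bound : Dec (ℓ ≤ rf) → #f + #g + #root < registers f ⊔ suc (registers g)
    bound (yes ℓ≤rf) = begin-strict
        #f + #g + #root
      ≡⟨ cong₂ (λ u v → #f + u + v) (#crossing-outside g (suc rf) ℓ (inj₁ (m≤n⇒m≤1+n ℓ≤rf)))
                                    (#crossing-fork≡0 rg ℓ≤rf) ⟩
        #f + 0 + 0
      ≡⟨ trans (+-identityʳ _) (+-identityʳ _) ⟩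
        #f
      <⟨ #crossing<registers f k ℓ ⟩
        registers f
      ≤⟨ m≤m⊔n _ _ ⟩
        registers f ⊔ suc (registers g) ∎
      where open ≤-Reasoning
    bound (no ℓ≰rf) = begin-strict
        #f + #g + #root
      ≡⟨ cong (λ u → u + #g + #root) (#crossing-outside f k ℓ (inj₂ (<⇒≤ (≰⇒> ℓ≰rf)))) ⟩
        #g + #root
      ≤⟨ +-monoʳ-≤ #g (#crossing-fork≤1 ℓ rf rg) ⟩
        #g + 1
      ≡⟨ +-comm #g 1 ⟩
        suc #g
      <⟨ s≤s (#crossing<registers g (suc rf) ℓ) ⟩
        suc (registers g)
      ≤⟨ m≤n⊔m _ _ ⟩
        registers f ⊔ suc (registers g) ∎
      where open ≤-Reasoning

compile-valid : ∀ {n} (f : Formula n) → ValidLayering (compile f) toℕ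
compile-valid f u v = edges-forward (append [] f)

compile-size : ∀ {n} (f : Formula n) → size (compile f) ≤ nodeCount f
compile-size f = ≤-trans (length-filter (T? ∘ lookup (gateFlags (append [] f))) (allFin (nodeCount f)))
                         (≤-reflexive (length-tabulate (λ i → i)))

compile-width : ∀ {n} (f : Formula n) → WidthAtMost (compile f) toℕ (registers f)
compile-width f ℓ = begin
    #gates + length (filterᵇ (crosses ℓ ∘ toℕ²) (edges (append [] f)))
  ≤⟨ +-monoˡ-≤ _ (≤-trans (length-filterᵇ-mono _ (λ i → toℕ i ≡ᵇ ℓ) (λ i → proj₂ ∘ T-∧⁻ {isGateAt i})
                                                (allFin (nodeCount f)))
                          (length-filter-toℕ≡ᵇ≤1 (nodeCount f) ℓ)) ⟩
    1 + length (filterᵇ (crosses ℓ ∘ toℕ²) (edges (append [] f)))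
  ≡⟨ cong suc (trans (sym (length-filterᵇ-map (crosses ℓ) toℕ² (edges (append [] f))))
                     (cong (#crossing ℓ) (edgesℕ-append [] f))) ⟩
    suc (#crossing ℓ (formulaEdges f 0))
  ≤⟨ #crossing<registers f 0 ℓ ⟩
    registers f ∎
  where
  open ≤-Reasoning
  isGateAt : Fin (nodeCount f) → Bool
  isGateAt = lookup (gateFlags (append [] f))
  #gates : ℕ
  #gates = length (filterᵇ (λ i → isGateAt i ∧ (toℕ i ≡ᵇ ℓ)) (allFin (nodeCount f)))

module _ {n : ℕ} where

  foldBin : BinOp → Bool → List (Formula n) → Formula n
  foldBin o e []       = cst e
  foldBin o e (f ∷ fs) = bin o (foldBin o e fs) f

  ⋁ ⋀ : List (Formula n) → Formula n
  ⋁ = foldBin or false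
  ⋀ = foldBin and true

  registers-foldBin : ∀ o e fs {r} → (∀ {f} → f ∈ fs → registers f ≤ r) → registers (foldBin o e fs) ≤ suc r
  registers-foldBin o e []       bound = s≤s z≤n
  registers-foldBin o e (f ∷ fs) bound = ⊔-lub (registers-foldBin o e fs (bound ∘ there)) (s≤s (bound (here refl)))

  nodeCount-foldBin : ∀ o e fs {s} → (∀ {f} → f ∈ fs → nodeCount f ≤ s) →
    nodeCount (foldBin o e fs) ≤ suc (length fs * suc s)
  nodeCount-foldBin o e []       bound = s≤s z≤n
  nodeCount-foldBin o e (f ∷ fs) {s} bound = begin
      nodeCount (foldBin o e (f ∷ fs))
    ≡⟨ nodeCount-bin o (foldBin o e fs) f ⟩
      suc (nodeCount (foldBin o e fs) + nodeCount f)
    ≤⟨ s≤s (+-mono-≤ (nodeCount-foldBin o e fs (bound ∘ there)) (bound (here refl))) ⟩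
      suc (suc (length fs * suc s) + s)
    ≡⟨ cong (suc ∘ suc) (+-comm (length fs * suc s) s) ⟩
      suc (length (f ∷ fs) * suc s) ∎
    where open ≤-Reasoning

  module _ (x : Fin n → Bool) where

    ⋁-sound : ∀ fs → ⟦ ⋁ fs ⟧ x ≡ true → Σ (Formula n) λ f → f ∈ fs × ⟦ f ⟧ x ≡ true
    ⋁-sound (f ∷ fs) holds with ⟦ ⋁ fs ⟧ x in eq
    ... | true  = let (g , g∈ , g-holds) = ⋁-sound fs eq in g , there g∈ , g-holds
    ... | false = f , here refl , holds

    ⋁-complete : ∀ fs {f} → f ∈ fs → ⟦ f ⟧ x ≡ true → ⟦ ⋁ fs ⟧ x ≡ true
    ⋁-complete (f ∷ fs) (here refl) holds rewrite holds = ∨-zeroʳ (⟦ ⋁ fs ⟧ x)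
    ⋁-complete (g ∷ fs) (there f∈) holds rewrite ⋁-complete fs f∈ holds = refl

    ⋀-sound : ∀ fs → ⟦ ⋀ fs ⟧ x ≡ true → ∀ {f} → f ∈ fs → ⟦ f ⟧ x ≡ true
    ⋀-sound (f ∷ fs) holds (here refl) = ∧-conicalʳ _ _ holds
    ⋀-sound (g ∷ fs) holds (there f∈)  = ⋀-sound fs (∧-conicalˡ _ _ holds) f∈

    ⋀-complete : ∀ fs → (∀ {f} → f ∈ fs → ⟦ f ⟧ x ≡ true) → ⟦ ⋀ fs ⟧ x ≡ true
    ⋀-complete []       all = refl
    ⋀-complete (f ∷ fs) all rewrite ⋀-complete fs (all ∘ there) | all (here refl) = refl

module Assignments {A : Set} (_≟_ : DecidableEquality A) where

  update : A → Bool → (A → Bool) → A → Bool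
  update u b β v = if does (v ≟ u) then b else β v

  assignments : List A → List (A → Bool)
  assignments []       = (λ _ → false) ∷ []
  assignments (u ∷ us) = map (update u true) (assignments us) ++ map (update u false) (assignments us)

  length-assignments : ∀ us → length (assignments us) ≡ 2 ^ length us
  length-assignments []       = refl
  length-assignments (u ∷ us) = begin
      length (map (update u true) (assignments us) ++ map (update u false) (assignments us))
    ≡⟨ length-++ (map (update u true) (assignments us)) ⟩
      length (map (update u true) (assignments us)) + length (map (update u false) (assignments us))
    ≡⟨ cong₂ _+_ (length-map _ (assignments us)) (trans (length-map _ (assignments us)) (sym (+-identityʳ _))) ⟩
      length (assignments us) + (length (assignments us) + 0)
    ≡⟨ cong (λ z → z + (z + 0)) (length-assignments us) ⟩
      2 ^ length (u ∷ us) ∎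
    where open ≡-Reasoning

  update-same : ∀ u b β → update u b β u ≡ b
  update-same u b β with u ≟ u
  ... | yes _  = refl
  ... | no u≢u = ⊥-elim (u≢u refl)

  assignments-complete : ∀ us (β : A → Bool) →
    Σ (A → Bool) λ γ → γ ∈ assignments us × (∀ {u} → u ∈ us → γ u ≡ β u)
  assignments-complete []       β = _ , here refl , λ ()
  assignments-complete (u ∷ us) β =
    let (γ , γ∈ , agree) = assignments-complete us β in update u (β u) γ , listed γ∈ , agree′ agree
    where
    listed : ∀ {γ} → γ ∈ assignments us → update u (β u) γ ∈ assignments (u ∷ us)
    listed γ∈ with β u
    ... | true  = ∈-++⁺ˡ (∈-map⁺ (update u true) γ∈)
    ... | false = ∈-++⁺ʳ (map (update u true) (assignments us)) (∈-map⁺ (update u false) γ∈)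
    agree′ : ∀ {γ} → (∀ {v} → v ∈ us → γ v ≡ β v) → ∀ {v} → v ∈ u ∷ us → update u (β u) γ v ≡ β v
    agree′ {γ} agree {v} (here refl) = update-same v (β v) γ
    agree′ agree {v} (there v∈) with v ≟ u
    ... | yes refl = refl
    ... | no _     = agree v∈

-- Reading a circuit node by node

data LastOrOld : (k : ℕ) → Fin (suc k) → Set where
  last : ∀ {k} → LastOrOld k (fromℕ k)
  old  : ∀ {k} (i : Fin k) → LastOrOld k (inject₁ i)

lastOrOld : ∀ {k} (i : Fin (suc k)) → LastOrOld k i
lastOrOld {zero}  Fin.zero    = last
lastOrOld {suc k} Fin.zero    = old Fin.zero
lastOrOld {suc k} (Fin.suc i) with lastOrOld i
... | last  = last
... | old j = old (Fin.suc j)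

lastOrOld-fromℕ : ∀ k → lastOrOld (fromℕ k) ≡ last
lastOrOld-fromℕ zero = refl
lastOrOld-fromℕ (suc k) rewrite lastOrOld-fromℕ k = refl

lastOrOld-inject₁ : ∀ {k} (i : Fin k) → lastOrOld (inject₁ i) ≡ old i
lastOrOld-inject₁ {suc k} Fin.zero    = refl
lastOrOld-inject₁ {suc k} (Fin.suc i) rewrite lastOrOld-inject₁ i = refl

lookup-∷ʳ-inject₁ : ∀ {A : Set} {k} (v : Vec A k) y (i : Fin k) → lookup (v ∷ʳ y) (inject₁ i) ≡ lookup v i
lookup-∷ʳ-inject₁ (x Vec.∷ v) y Fin.zero    = refl
lookup-∷ʳ-inject₁ (x Vec.∷ v) y (Fin.suc i) = lookup-∷ʳ-inject₁ v y i

module _ {n m : ℕ} where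

  weaken : ∀ {k} → Node n m k → Node n m (suc k)
  weaken (input l) = input l
  weaken (AND a b) = AND (inject₁ a) (inject₁ b)
  weaken (OR a b)  = OR (inject₁ a) (inject₁ b)
  weaken (NOT a)   = NOT (inject₁ a)

  nodeAt : ∀ {k} → Nodes n m k → Fin k → Node n m k
  nodeAt (C ▷ g) i with lastOrOld i
  ... | last  = weaken g
  ... | old j = weaken (nodeAt C j)

  nodeAt-last : ∀ {k} (C : Nodes n m k) g → nodeAt (C ▷ g) (fromℕ k) ≡ weaken g
  nodeAt-last {k} C g rewrite lastOrOld-fromℕ k = refl

  nodeAt-old : ∀ {k} (C : Nodes n m k) g i → nodeAt (C ▷ g) (inject₁ i) ≡ weaken (nodeAt C i)
  nodeAt-old C g i rewrite lastOrOld-inject₁ i = refl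

  children : ∀ {k} → Node n m k → List (Fin k)
  children (input _) = []
  children (AND a b) = a ∷ b ∷ []
  children (OR a b)  = a ∷ b ∷ []
  children (NOT a)   = a ∷ []

  nodeValue : ∀ {k} → Node n m k → (Fin k → Bool) → (Fin n → Bool) → (Fin m → Bool) → Bool
  nodeValue (input l) α x y = labelVal l x y
  nodeValue (AND a b) α x y = α a ∧ α b
  nodeValue (OR a b)  α x y = α a ∨ α b
  nodeValue (NOT a)   α x y = not (α a)

  weaken-input : ∀ {k} {g : Node n m k} {l} → weaken g ≡ input l → g ≡ input l
  weaken-input {g = input _} refl = refl

  isGate-weaken : ∀ {k} (g : Node n m k) → isGate (weaken g) ≡ isGate g
  isGate-weaken (input _) = refl
  isGate-weaken (AND _ _) = refl
  isGate-weaken (OR _ _)  = refl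
  isGate-weaken (NOT _)   = refl

  children-weaken : ∀ {k} (g : Node n m k) → children (weaken g) ≡ map inject₁ (children g)
  children-weaken (input _) = refl
  children-weaken (AND _ _) = refl
  children-weaken (OR _ _)  = refl
  children-weaken (NOT _)   = refl

  nodeValue-local : ∀ {k} (g : Node n m k) {α β : Fin k → Bool} x y →
    (∀ {c} → c ∈ children g → α c ≡ β c) → nodeValue g α x y ≡ nodeValue g β x y
  nodeValue-local (input _) x y same = refl
  nodeValue-local (AND a b) x y same = cong₂ _∧_ (same (here refl)) (same (there (here refl)))
  nodeValue-local (OR a b)  x y same = cong₂ _∨_ (same (here refl)) (same (there (here refl)))
  nodeValue-local (NOT a)   x y same = cong not (same (here refl))

  nodeValue-weaken : ∀ {k} (g : Node n m k) α x y → nodeValue (weaken g) α x y ≡ nodeValue g (α ∘ inject₁) x y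
  nodeValue-weaken (input _) α x y = refl
  nodeValue-weaken (AND _ _) α x y = refl
  nodeValue-weaken (OR _ _)  α x y = refl
  nodeValue-weaken (NOT _)   α x y = refl

  child⇒isGate : ∀ {k} (g : Node n m k) {c} → c ∈ children g → isGate g ≡ true
  child⇒isGate (AND _ _) _ = refl
  child⇒isGate (OR _ _)  _ = refl
  child⇒isGate (NOT _)   _ = refl

  isGate⇒child : ∀ {k} (g : Node n m k) → isGate g ≡ true → Σ (Fin k) (_∈ children g)
  isGate⇒child (AND a _) _ = a , here refl
  isGate⇒child (OR a _)  _ = a , here refl
  isGate⇒child (NOT a)   _ = a , here refl

  gateFlags-nodeAt : ∀ {k} (C : Nodes n m k) i → lookup (gateFlags C) i ≡ isGate (nodeAt C i)
  gateFlags-nodeAt (C ▷ g) i with lastOrOld i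
  ... | last  = trans (lookup-∷ʳ-fromℕ (gateFlags C) _) (sym (isGate-weaken g))
  ... | old j = trans (lookup-∷ʳ-inject₁ (gateFlags C) _ j)
                      (trans (gateFlags-nodeAt C j) (sym (isGate-weaken (nodeAt C j))))

  nodeVal-nodeValue : ∀ {k} (g : Node n m k) x y v → nodeVal g x y v ≡ nodeValue g (lookup v) x y
  nodeVal-nodeValue (input _) x y v = refl
  nodeVal-nodeValue (AND _ _) x y v = refl
  nodeVal-nodeValue (OR _ _)  x y v = refl
  nodeVal-nodeValue (NOT _)   x y v = refl

  nodeValue-weaken-▷ : ∀ {k} (C : Nodes n m k) g h x y →
    nodeValue (weaken h) (lookup (values (C ▷ g) x y)) x y ≡ nodeValue h (lookup (values C x y)) x y
  nodeValue-weaken-▷ C g h x y =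
    trans (nodeValue-weaken h _ x y) (nodeValue-local h x y (λ {c} _ → lookup-∷ʳ-inject₁ (values C x y) _ c))

  values-nodeAt : ∀ {k} (C : Nodes n m k) x y i →
    lookup (values C x y) i ≡ nodeValue (nodeAt C i) (lookup (values C x y)) x y
  values-nodeAt (C ▷ g) x y i with lastOrOld i
  ... | last = begin
      lookup (values C x y ∷ʳ nodeVal g x y (values C x y)) (fromℕ _)
    ≡⟨ lookup-∷ʳ-fromℕ (values C x y) _ ⟩
      nodeVal g x y (values C x y)
    ≡⟨ nodeVal-nodeValue g x y (values C x y) ⟩
      nodeValue g (lookup (values C x y)) x y
    ≡⟨ sym (nodeValue-weaken-▷ C g g x y) ⟩
      nodeValue (weaken g) (lookup (values (C ▷ g) x y)) x y ∎
    where open ≡-Reasoning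
  ... | old j = begin
      lookup (values C x y ∷ʳ nodeVal g x y (values C x y)) (inject₁ j)
    ≡⟨ lookup-∷ʳ-inject₁ (values C x y) _ j ⟩
      lookup (values C x y) j
    ≡⟨ values-nodeAt C x y j ⟩
      nodeValue (nodeAt C j) (lookup (values C x y)) x y
    ≡⟨ sym (nodeValue-weaken-▷ C g (nodeAt C j) x y) ⟩
      nodeValue (weaken (nodeAt C j)) (lookup (values (C ▷ g) x y)) x y ∎
    where open ≡-Reasoning

  nodeEdges⇒child : ∀ {k} (g : Node n m k) {u v} → (u , v) ∈ nodeEdges g → v ≡ fromℕ k × u ∈ map inject₁ (children g)
  nodeEdges⇒child (AND a b) (here refl)         = refl , here refl
  nodeEdges⇒child (AND a b) (there (here refl)) = refl , there (here refl)
  nodeEdges⇒child (OR a b)  (here refl)         = refl , here refl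
  nodeEdges⇒child (OR a b)  (there (here refl)) = refl , there (here refl)
  nodeEdges⇒child (NOT a)   (here refl)         = refl , here refl

  child⇒nodeEdges : ∀ {k} (g : Node n m k) {c} → c ∈ children g → (inject₁ c , fromℕ k) ∈ nodeEdges g
  child⇒nodeEdges (AND a b) (here refl)         = here refl
  child⇒nodeEdges (AND a b) (there (here refl)) = there (here refl)
  child⇒nodeEdges (OR a b)  (here refl)         = here refl
  child⇒nodeEdges (OR a b)  (there (here refl)) = there (here refl)
  child⇒nodeEdges (NOT a)   (here refl)         = here refl

  child⇒edge : ∀ {k} (C : Nodes n m k) i {c} → c ∈ children (nodeAt C i) → (c , i) ∈ edges C
  child⇒edge (C ▷ g) i c∈ with lastOrOld i
  ... | last rewrite children-weaken g with ∈-map⁻ inject₁ c∈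
  ...   | c′ , c′∈ , refl = ∈-++⁺ʳ _ (child⇒nodeEdges g c′∈)
  child⇒edge (C ▷ g) i c∈ | old j rewrite children-weaken (nodeAt C j) with ∈-map⁻ inject₁ c∈
  ...   | c′ , c′∈ , refl = ∈-++⁺ˡ (∈-map⁺ inject₁² (child⇒edge C j c′∈))

  edge⇒child : ∀ {k} (C : Nodes n m k) {u v} → (u , v) ∈ edges C → u ∈ children (nodeAt C v)
  edge⇒child (C ▷ g) e∈ with ∈-++⁻ (map inject₁² (edges C)) e∈
  ... | inj₂ e∈g with nodeEdges⇒child g e∈g
  ...   | refl , u∈ rewrite nodeAt-last C g | children-weaken g = u∈
  edge⇒child (C ▷ g) e∈ | inj₁ e∈C with ∈-map⁻ inject₁² e∈C
  ...   | (u , v) , uv∈ , refl rewrite nodeAt-old C g v | children-weaken (nodeAt C v) =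
    ∈-map⁺ inject₁ (edge⇒child C uv∈)

  isGuessNode : ∀ {k} → Fin m → Node n m k → Bool
  isGuessNode j (input l) = isGuess j l
  isGuessNode j _         = false

  guessValue : ∀ {k} → Nodes n m k → (Fin k → Bool) → Fin m → Bool
  guessValue []      α j = false
  guessValue (C ▷ g) α j = if isGuessNode j g then α (fromℕ _) else guessValue C (α ∘ inject₁) j

  #guess : ∀ {k} → Nodes n m k → Fin m → ℕ
  #guess C j = length (filterᵇ (isGuess j) (nodeLabels C))

  isGuess-refl : ∀ j → isGuess {n} {m} j (guess j) ≡ true
  isGuess-refl j with j Data.Fin.≟ j
  ... | yes _  = refl
  ... | no j≢j = ⊥-elim (j≢j refl)

  #guess-▷ : ∀ {k} (C : Nodes n m k) g j → #guess C j ≤ #guess (C ▷ g) j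
  #guess-▷ C (input l) j = ≤-trans (m≤m+n _ _) (≤-reflexive (sym (length-filterᵇ-++ (isGuess j) (nodeLabels C) (l ∷ []))))
  #guess-▷ C (AND _ _) j = ≤-refl
  #guess-▷ C (OR _ _)  j = ≤-refl
  #guess-▷ C (NOT _)   j = ≤-refl

  #guess-▷-guess : ∀ {k} (C : Nodes n m k) g j → isGuessNode j g ≡ true → #guess (C ▷ g) j ≡ suc (#guess C j)
  #guess-▷-guess C (input l) j is rewrite length-filterᵇ-++ (isGuess j) (nodeLabels C) (l ∷ []) | is = +-comm _ 1

  #guess-positive : ∀ {k} (C : Nodes n m k) i j → nodeAt C i ≡ input (guess j) → 1 ≤ #guess C j
  #guess-positive (C ▷ g) i j at with lastOrOld i
  ... | last with weaken-input at
  ...   | refl = subst (1 ≤_) (sym (#guess-▷-guess C (input (guess j)) j (isGuess-refl j))) (s≤s z≤n)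
  #guess-positive (C ▷ g) i j at | old i′ = ≤-trans (#guess-positive C i′ j (weaken-input at)) (#guess-▷ C g j)

  guessValue-correct : ∀ {k} (C : Nodes n m k) α i j → #guess C j ≤ 1 → nodeAt C i ≡ input (guess j) → guessValue C α j ≡ α i
  guessValue-correct (C ▷ g) α i j once at with lastOrOld i
  ... | last with weaken-input at
  ...   | refl rewrite isGuess-refl j = refl
  guessValue-correct (C ▷ g) α i j once at | old i′ with isGuessNode j g in is
  ... | true  = ⊥-elim (<⇒≱ (s≤s (#guess-positive C i′ j (weaken-input at))) (subst (_≤ 1) (#guess-▷-guess C g j is) once))
  ... | false = guessValue-correct C (α ∘ inject₁) i′ j (≤-trans (#guess-▷ C g j) once) (weaken-input at)

module _ {n m : ℕ} where

  -- Guess nodes are unconstrained: the existential quantifier over guesses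
  -- becomes a choice of their values.
  NodeCorrect : ∀ {k} → Node n m k → (Fin n → Bool) → (Fin k → Bool) → Bool → Set
  NodeCorrect (input (guess _)) x α b = ⊤
  NodeCorrect g                 x α b = b ≡ nodeValue g α x (λ _ → false)

  NodeCorrect-local : ∀ {k} (g : Node n m k) x {α β} {b} → (∀ {c} → c ∈ children g → α c ≡ β c) →
    NodeCorrect g x α b → NodeCorrect g x β b
  NodeCorrect-local (input (var _))   x same ok = ok
  NodeCorrect-local (input (const _)) x same ok = ok
  NodeCorrect-local (input (guess _)) x same ok = ok
  NodeCorrect-local (AND a b) x same ok = trans ok (nodeValue-local {n} {m} (AND a b) x (λ _ → false) same)
  NodeCorrect-local (OR a b)  x same ok = trans ok (nodeValue-local {n} {m} (OR a b) x (λ _ → false) same)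
  NodeCorrect-local (NOT a)   x same ok = trans ok (nodeValue-local {n} {m} (NOT a) x (λ _ → false) same)

  nodeValue⇒NodeCorrect : ∀ {k} (g : Node n m k) x α y {b} → b ≡ nodeValue g α x y → NodeCorrect g x α b
  nodeValue⇒NodeCorrect (input (var _))   x α y eq = eq
  nodeValue⇒NodeCorrect (input (const _)) x α y eq = eq
  nodeValue⇒NodeCorrect (input (guess _)) x α y eq = tt
  nodeValue⇒NodeCorrect (AND _ _) x α y eq = eq
  nodeValue⇒NodeCorrect (OR _ _)  x α y eq = eq
  nodeValue⇒NodeCorrect (NOT _)   x α y eq = eq

  NodeCorrect⇒nodeValue : ∀ {k} (g : Node n m k) x α y {b} → NodeCorrect g x α b →
    (∀ {j} → g ≡ input (guess j) → b ≡ y j) → b ≡ nodeValue g α x y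
  NodeCorrect⇒nodeValue (input (var _))   x α y ok guessed = ok
  NodeCorrect⇒nodeValue (input (const _)) x α y ok guessed = ok
  NodeCorrect⇒nodeValue (input (guess _)) x α y ok guessed = guessed refl
  NodeCorrect⇒nodeValue (AND _ _) x α y ok guessed = ok
  NodeCorrect⇒nodeValue (OR _ _)  x α y ok guessed = ok
  NodeCorrect⇒nodeValue (NOT _)   x α y ok guessed = ok

  correctFormula : ∀ {k} → Node n m k → (Fin k → Bool) → Bool → Formula n
  correctFormula (input (var j))   α b = if b then lit j else neg (lit j)
  correctFormula (input (guess _)) α b = cst true
  correctFormula g                 α b = cst (does (b Data.Bool.≟ nodeValue g α (λ _ → false) (λ _ → false)))

  correctFormula-sound : ∀ {k} (g : Node n m k) x α b → ⟦ correctFormula g α b ⟧ x ≡ true → NodeCorrect g x α b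
  correctFormula-sound (input (var j)) x α true  holds = sym holds
  correctFormula-sound (input (var j)) x α false holds with x j
  ... | false = refl
  correctFormula-sound (input (const _)) x α b holds = does-sound holds
  correctFormula-sound (input (guess _)) x α b holds = tt
  correctFormula-sound (AND _ _) x α b holds = does-sound holds
  correctFormula-sound (OR _ _)  x α b holds = does-sound holds
  correctFormula-sound (NOT _)   x α b holds = does-sound holds

  correctFormula-complete : ∀ {k} (g : Node n m k) x α b → NodeCorrect g x α b → ⟦ correctFormula g α b ⟧ x ≡ true
  correctFormula-complete (input (var j)) x α true  ok = sym ok
  correctFormula-complete (input (var j)) x α false ok rewrite sym ok = refl
  correctFormula-complete (input (const _)) x α b ok = does-complete ok
  correctFormula-complete (input (guess _)) x α b ok = refl
  correctFormula-complete (AND _ _) x α b ok = does-complete ok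
  correctFormula-complete (OR _ _)  x α b ok = does-complete ok
  correctFormula-complete (NOT _)   x α b ok = does-complete ok

  registers-correctFormula : ∀ {k} (g : Node n m k) α b → registers (correctFormula g α b) ≤ 1
  registers-correctFormula (input (var j)) α true  = ≤-refl
  registers-correctFormula (input (var j)) α false = ≤-refl
  registers-correctFormula (input (const _)) α b = ≤-refl
  registers-correctFormula (input (guess _)) α b = ≤-refl
  registers-correctFormula (AND _ _) α b = ≤-refl
  registers-correctFormula (OR _ _)  α b = ≤-refl
  registers-correctFormula (NOT _)   α b = ≤-refl

  nodeCount-correctFormula : ∀ {k} (g : Node n m k) α b → nodeCount (correctFormula g α b) ≤ 2
  nodeCount-correctFormula (input (var j)) α true  = s≤s z≤n
  nodeCount-correctFormula (input (var j)) α false = ≤-refl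
  nodeCount-correctFormula (input (const _)) α b = s≤s z≤n
  nodeCount-correctFormula (input (guess _)) α b = s≤s z≤n
  nodeCount-correctFormula (AND _ _) α b = s≤s z≤n
  nodeCount-correctFormula (OR _ _)  α b = s≤s z≤n
  nodeCount-correctFormula (NOT _)   α b = s≤s z≤n

-- Arithmetic of the bounds

n<2^n : ∀ n → n < 2 ^ n
n<2^n zero    = s≤s z≤n
n<2^n (suc n) = begin-strict
    suc n
  <⟨ s≤s (n<2^n n) ⟩
    suc (2 ^ n)
  ≤⟨ +-monoˡ-≤ (2 ^ n) (m^n>0 2 n) ⟩
    2 ^ n + 2 ^ n
  ≡⟨ cong (2 ^ n +_) (sym (+-identityʳ (2 ^ n))) ⟩
    2 ^ suc n ∎
  where open ≤-Reasoning

n≤2^⌈log₂n⌉ : ∀ n → n ≤ 2 ^ ⌈log₂ n ⌉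
n≤2^⌈log₂n⌉ = <-rec (λ n → n ≤ 2 ^ ⌈log₂ n ⌉) step
  where
  step : ∀ n → (∀ {m} → m < n → m ≤ 2 ^ ⌈log₂ m ⌉) → n ≤ 2 ^ ⌈log₂ n ⌉
  step zero          rec = z≤n
  step (suc zero)    rec = s≤s z≤n
  step n@(suc (suc k)) rec = begin
      n
    ≡⟨ sym (⌊n/2⌋+⌈n/2⌉≡n n) ⟩
      ⌊ n /2⌋ + ⌈ n /2⌉
    ≤⟨ +-monoˡ-≤ ⌈ n /2⌉ (⌊n/2⌋≤⌈n/2⌉ n) ⟩
      ⌈ n /2⌉ + ⌈ n /2⌉
    ≤⟨ +-mono-≤ half≤ half≤ ⟩
      2 ^ (⌈log₂ n ⌉ ∸ 1) + 2 ^ (⌈log₂ n ⌉ ∸ 1)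
    ≡⟨ cong (2 ^ (⌈log₂ n ⌉ ∸ 1) +_) (sym (+-identityʳ _)) ⟩
      2 ^ suc (⌈log₂ n ⌉ ∸ 1)
    ≡⟨ cong (2 ^_) (trans (+-comm 1 _) (m∸n+n≡m 1≤log)) ⟩
      2 ^ ⌈log₂ n ⌉ ∎
    where
    open ≤-Reasoning
    1≤log : 1 ≤ ⌈log₂ n ⌉
    1≤log = ⌈log₂⌉-mono-≤ {2} {n} (s≤s (s≤s z≤n))
    half≤ : ⌈ n /2⌉ ≤ 2 ^ (⌈log₂ n ⌉ ∸ 1)
    half≤ = subst (λ e → ⌈ n /2⌉ ≤ 2 ^ e) (⌈log₂⌈n/2⌉⌉≡⌈log₂n⌉∸1 n) (rec (⌈n/2⌉<n k))

sizeExponent : ℕ → ℕ → ℕ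
sizeExponent w d = (w + 3) * d + (6 * w + 8)

sizeExponent-zero : ∀ w → sizeExponent w 0 ≡ 6 * w + 8
sizeExponent-zero w = cong (_+ (6 * w + 8)) (*-zeroʳ (w + 3))

sizeExponent-suc : ∀ w d → w + 3 + sizeExponent w d ≡ sizeExponent w (suc d)
sizeExponent-suc = identity
  where
  identity : ∀ w d → w + 3 + ((w + 3) * d + (6 * w + 8)) ≡ (w + 3) * suc d + (6 * w + 8)
  identity = solve-∀

sizeExponent-base : ∀ w → suc (2 ^ (5 * w + 2) * suc (suc ((7 * w + 4) * 3))) ≤ 2 ^ sizeExponent w 0
sizeExponent-base w = begin
    suc (2 ^ (5 * w + 2) * suc (suc ((7 * w + 4) * 3)))
  ≤⟨ s≤s (*-monoʳ-≤ (2 ^ (5 * w + 2)) checks≤) ⟩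
    suc (2 ^ (5 * w + 2) * 2 ^ (w + 5))
  ≡⟨ cong suc (trans (sym (^-distribˡ-+-* 2 (5 * w + 2) (w + 5))) (cong (2 ^_) (exponents w))) ⟩
    suc (2 ^ (6 * w + 7))
  ≤⟨ +-monoˡ-≤ (2 ^ (6 * w + 7)) (m^n>0 2 (6 * w + 7)) ⟩
    2 ^ (6 * w + 7) + 2 ^ (6 * w + 7)
  ≡⟨ cong (2 ^ (6 * w + 7) +_) (sym (+-identityʳ _)) ⟩
    2 ^ suc (6 * w + 7)
  ≡⟨ cong (2 ^_) (sym (+-suc (6 * w) 7)) ⟩
    2 ^ (6 * w + 8)
  ≡⟨ cong (2 ^_) (sym (sizeExponent-zero w)) ⟩
    2 ^ sizeExponent w 0 ∎
  where
  open ≤-Reasoning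
  exponents : ∀ w → 5 * w + 2 + (w + 5) ≡ 6 * w + 7
  exponents = solve-∀
  checks≤ : suc (suc ((7 * w + 4) * 3)) ≤ 2 ^ (w + 5)
  checks≤ = begin
      suc (suc ((7 * w + 4) * 3))
    ≤⟨ ≤-reflexive (lhs w) ⟩
      21 * w + 14
    ≤⟨ m≤m+n (21 * w + 14) (11 * w + 18) ⟩
      21 * w + 14 + (11 * w + 18)
    ≡⟨ rhs w ⟩
      32 * (w + 1)
    ≤⟨ *-monoʳ-≤ 32 (≤-trans (≤-reflexive (+-comm w 1)) (n<2^n w)) ⟩
      32 * 2 ^ w
    ≡⟨ trans (*-comm 32 (2 ^ w)) (sym (^-distribˡ-+-* 2 w 5)) ⟩
      2 ^ (w + 5) ∎
    where
    lhs : ∀ w → suc (suc ((7 * w + 4) * 3)) ≡ 21 * w + 14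
    lhs = solve-∀
    rhs : ∀ w → 21 * w + 14 + (11 * w + 18) ≡ 32 * (w + 1)
    rhs = solve-∀

fork-size-bound : ∀ P X → 1 ≤ P → 2 ≤ X → suc (P * suc (suc (X + X))) ≤ P * 4 * X
fork-size-bound (suc Q) (suc zero)    _ (s≤s ())
fork-size-bound (suc Q) (suc (suc Y)) _ _ = begin
    suc (suc Q * suc (suc (suc (suc Y) + suc (suc Y))))
  ≤⟨ m≤m+n _ (1 + 2 * Q + 2 * (suc Q * Y)) ⟩
    suc (suc Q * suc (suc (suc (suc Y) + suc (suc Y)))) + (1 + 2 * Q + 2 * (suc Q * Y))
  ≡⟨ identity Q Y ⟩
    suc Q * 4 * suc (suc Y) ∎
  where
  open ≤-Reasoning
  identity : ∀ Q Y → suc (suc Q * suc (suc (suc (suc Y) + suc (suc Y)))) + (1 + 2 * Q + 2 * (suc Q * Y))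
                     ≡ suc Q * 4 * suc (suc Y)
  identity = solve-∀

sizeExponent-step : ∀ w d → let E = sizeExponent w d in
  suc (2 ^ suc w * suc (suc (2 ^ E + 2 ^ E))) ≤ 2 ^ sizeExponent w (suc d)
sizeExponent-step w d = begin
    suc (2 ^ suc w * suc (suc (2 ^ E + 2 ^ E)))
  ≤⟨ fork-size-bound (2 ^ suc w) (2 ^ E) (m^n>0 2 (suc w)) (^-monoʳ-≤ 2 1≤E) ⟩
    2 ^ suc w * 2 ^ 2 * 2 ^ E
  ≡⟨ cong (_* 2 ^ E) (sym (^-distribˡ-+-* 2 (suc w) 2)) ⟩
    2 ^ (suc w + 2) * 2 ^ E
  ≡⟨ sym (^-distribˡ-+-* 2 (suc w + 2) E) ⟩
    2 ^ (suc w + 2 + E)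
  ≡⟨ cong (λ e → 2 ^ (e + E)) (sym (+-suc w 2)) ⟩
    2 ^ (w + 3 + E)
  ≡⟨ cong (2 ^_) (sizeExponent-suc w d) ⟩
    2 ^ sizeExponent w (suc d) ∎
  where
  open ≤-Reasoning
  E : ℕ
  E = sizeExponent w d
  1≤E : 1 ≤ E
  1≤E = ≤-trans (≤-trans (s≤s z≤n) (m≤n+m 8 (6 * w))) (m≤n+m (6 * w + 8) ((w + 3) * d))

sizeExponent≤ : ∀ w D → 1 ≤ D → sizeExponent w D ≤ 11 * ((w + D) * D)
sizeExponent≤ w (suc e) _ = ≤-trans (m≤m+n _ (10 * (w * e) + 4 * w + 11 * (e * e) + 19 * e)) (≤-reflexive (identity w e))
  where
  identity : ∀ w e → (w + 3) * suc e + (6 * w + 8) + (10 * (w * e) + 4 * w + 11 * (e * e) + 19 * e)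
                     ≡ 11 * ((w + suc e) * suc e)
  identity = solve-∀

width≤ : ∀ w D → 1 ≤ D → 3 + 2 * D ≤ w + 11 * D
width≤ w (suc e) _ = ≤-trans (m≤m+n _ (w + 6 + 9 * e)) (≤-reflexive (identity w e))
  where
  identity : ∀ w e → 3 + 2 * suc e + (w + 6 + 9 * e) ≡ w + 11 * suc e
  identity = solve-∀

-- Frontiers and segments of a layered circuit

module Segments {n m : ℕ} (C : Circuit n m) (L : Layering C) (valid : ValidLayering C L) where

  node : Fin (N C) → Node n m (N C)
  node = nodeAt (nodes C)

  isGateAt : Fin (N C) → Bool
  isGateAt u = isGate (node u)

  child< : ∀ u {c} → c ∈ children (node u) → L c < L u
  child< u c∈ = valid _ u (child⇒edge (nodes C) u c∈)

  -- A gate is settled at threshold t once its layer is ≤ t, an input node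
  -- once its layer is < t: a segment (t , t′] of the circuit computes the
  -- gates of layers t+1 … t′ from the inputs of layers t … t′-1.
  settled : ℕ → Fin (N C) → Bool
  settled t u = if isGateAt u then L u <ᵇ suc t else L u <ᵇ t

  settled-gate : ∀ {t u} → isGateAt u ≡ true → L u ≤ t → settled t u ≡ true
  settled-gate {t} {u} gate le rewrite gate = <ᵇ-true (s≤s le)

  settled-< : ∀ {t u} → L u < t → settled t u ≡ true
  settled-< {t} {u} lt with isGateAt u
  ... | true  = <ᵇ-true (m≤n⇒m≤1+n lt)
  ... | false = <ᵇ-true lt

  settled⇒≤ : ∀ {t u} → settled t u ≡ true → L u ≤ t
  settled⇒≤ {t} {u} st with isGateAt u
  ... | true  = ≤-pred (<ᵇ-true⁻ st)
  ... | false = <⇒≤ (<ᵇ-true⁻ st)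

  settled-input⇒< : ∀ {t u} → isGateAt u ≡ false → settled t u ≡ true → L u < t
  settled-input⇒< {t} {u} notGate st rewrite notGate = <ᵇ-true⁻ st

  unsettled⇒≤ : ∀ {t u} → settled t u ≡ false → t ≤ L u
  unsettled⇒≤ {t} {u} st with L u <? t
  ... | yes lt = ⊥-elim (false≢true (trans (sym st) (settled-< lt)))
  ... | no  ≮  = ≮⇒≥ ≮

  unsettled-gate⇒< : ∀ {t u} → isGateAt u ≡ true → settled t u ≡ false → t < L u
  unsettled-gate⇒< {t} {u} gate st rewrite gate = ≤-pred (<ᵇ-false⁻ st)

  settled-mono : ∀ {t t′ u} → t ≤ t′ → settled t u ≡ true → settled t′ u ≡ true
  settled-mono {t} {t′} {u} le st with true-or-false (isGateAt u)
  ... | inj₁ gate    = settled-gate gate (≤-trans (settled⇒≤ st) le)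
  ... | inj₂ notGate = settled-< (<-≤-trans (settled-input⇒< notGate st) le)

  unsettled-mono : ∀ {t t′ u} → t ≤ t′ → settled t′ u ≡ false → settled t u ≡ false
  unsettled-mono {t} {t′} {u} le st with settled t u in s
  ... | true  = ⊥-elim (false≢true (trans (sym st) (settled-mono le s)))
  ... | false = refl

  children-settled : ∀ {t u c} → settled t u ≡ true → c ∈ children (node u) → settled t c ≡ true
  children-settled {u = u} st c∈ = settled-< (<-≤-trans (child< u c∈) (settled⇒≤ st))

  isGateOfLayer : ℕ → Fin (N C) → Bool
  isGateOfLayer t i = lookup (gateFlags (nodes C)) i ∧ (L i ≡ᵇ t)

  jumpsOver : ℕ → Fin (N C) × Fin (N C) → Bool
  jumpsOver t e = (L (proj₁ e) <ᵇ t) ∧ (t <ᵇ L (proj₂ e))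

  gatesAt : ℕ → List (Fin (N C))
  gatesAt t = filterᵇ (isGateOfLayer t) (allFin (N C))

  crossingAt : ℕ → List (Fin (N C) × Fin (N C))
  crossingAt t = filterᵇ (jumpsOver t) (edges (nodes C))

  outputIfSettled : ℕ → List (Fin (N C))
  outputIfSettled t = if settled t (output C) then output C ∷ [] else []

  frontier : ℕ → List (Fin (N C))
  frontier t = gatesAt t ++ map proj₁ (crossingAt t) ++ outputIfSettled t

  data OnFrontier (t : ℕ) (u : Fin (N C)) : Set where
    gateAt   : isGateAt u ≡ true → L u ≡ t → OnFrontier t u
    crossing : ∀ {v} → (u , v) ∈ edges (nodes C) → L u < t → t < L v → OnFrontier t u
    settledOutput : u ≡ output C → settled t (output C) ≡ true → OnFrontier t u

  gatesAt⁻ : ∀ {t u} → u ∈ gatesAt t → isGateAt u ≡ true × L u ≡ t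
  gatesAt⁻ {t} {u} u∈ =
    let (_ , both) = ∈-filter⁻ (T? ∘ isGateOfLayer t) {xs = allFin (N C)} u∈ in
    trans (sym (gateFlags-nodeAt (nodes C) u)) (T⇒≡true (proj₁ (T-∧⁻ both))) , ≡ᵇ⇒≡ _ _ (proj₂ (T-∧⁻ both))

  gatesAt⁺ : ∀ {t u} → isGateAt u ≡ true → L u ≡ t → u ∈ gatesAt t
  gatesAt⁺ {t} {u} gate refl = ∈-filter⁺ (T? ∘ isGateOfLayer t) (∈-allFin u)
    (T-∧⁺ (≡true⇒T (trans (gateFlags-nodeAt (nodes C) u) gate)) (≡⇒≡ᵇ (L u) (L u) refl))

  frontier⁻ : ∀ {t u} → u ∈ frontier t → OnFrontier t u
  frontier⁻ {t} {u} u∈ with ∈-++⁻ (gatesAt t) u∈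
  ... | inj₁ u∈g = let (gate , at) = gatesAt⁻ u∈g in gateAt gate at
  ... | inj₂ u∈r with ∈-++⁻ (map proj₁ (crossingAt t)) u∈r
  ...   | inj₁ u∈c with ∈-map⁻ proj₁ u∈c
  ...     | (u , v) , uv∈ , refl =
    let (e∈ , both) = ∈-filter⁻ (T? ∘ jumpsOver t) {xs = edges (nodes C)} uv∈ in
    crossing e∈ (<ᵇ⇒< _ _ (proj₁ (T-∧⁻ both))) (<ᵇ⇒< _ _ (proj₂ (T-∧⁻ both)))
  frontier⁻ {t} {u} u∈ | inj₂ u∈r | inj₂ u∈o with settled t (output C) in st
  frontier⁻ {t} {u} u∈ | inj₂ u∈r | inj₂ (here refl) | true = settledOutput refl st

  frontier⁺ : ∀ {t u} → OnFrontier t u → u ∈ frontier t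
  frontier⁺ (gateAt gate at) = ∈-++⁺ˡ (gatesAt⁺ gate at)
  frontier⁺ {t} (crossing {v} e∈ lt gt) = ∈-++⁺ʳ (gatesAt t) (∈-++⁺ˡ (∈-map⁺ proj₁
    (∈-filter⁺ (T? ∘ jumpsOver t) e∈ (T-∧⁺ (<⇒<ᵇ lt) (<⇒<ᵇ gt)))))
  frontier⁺ {t} (settledOutput refl st) = ∈-++⁺ʳ (gatesAt t) (∈-++⁺ʳ (map proj₁ (crossingAt t)) out∈)
    where
    out∈ : output C ∈ outputIfSettled t
    out∈ rewrite st = here refl

  frontier-settled : ∀ {t u} → u ∈ frontier t → settled t u ≡ true
  frontier-settled u∈ with frontier⁻ u∈
  ... | gateAt gate at     = settled-gate gate (≤-reflexive at)
  ... | crossing _ lt _    = settled-< lt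
  ... | settledOutput refl st = st

  settled-edge⇒frontier : ∀ {t u v} → settled t u ≡ true → (u , v) ∈ edges (nodes C) → t < L v → u ∈ frontier t
  settled-edge⇒frontier {t} {u} st e∈ gt with m≤n⇒m<n∨m≡n (settled⇒≤ st)
  ... | inj₁ lt = frontier⁺ (crossing e∈ lt gt)
  ... | inj₂ at with true-or-false (isGateAt u)
  ...   | inj₁ gate    = frontier⁺ (gateAt gate at)
  ...   | inj₂ notGate = ⊥-elim (<⇒≢ (settled-input⇒< notGate st) at)

  frontier-settled-earlier : ∀ {t t′ u} → t ≤ t′ → u ∈ frontier t′ → settled t u ≡ true → u ∈ frontier t
  frontier-settled-earlier le u∈ st with frontier⁻ u∈
  ... | gateAt gate refl   = frontier⁺ (gateAt gate (≤-antisym (settled⇒≤ st) le))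
  ... | crossing e∈ _ gt   = settled-edge⇒frontier st e∈ (≤-<-trans le gt)
  ... | settledOutput refl _ = frontier⁺ (settledOutput refl st)

  -- An input node that feeds no gate and is not the output is irrelevant:
  -- it is on no frontier, so its value is never checked.
  Relevant : Fin (N C) → Set
  Relevant u = isGateAt u ≡ true ⊎ (Σ (Fin (N C)) λ v → (u , v) ∈ edges (nodes C)) ⊎ u ≡ output C

  module _ (x : Fin n → Bool) where

    Consistent : ℕ → ℕ → (Fin (N C) → Bool) → Set
    Consistent t t′ α = ∀ u → Relevant u → settled t u ≡ false → settled t′ u ≡ true → NodeCorrect (node u) x α (α u)

    AgreesOn : ℕ → (Fin (N C) → Bool) → (Fin (N C) → Bool) → Set
    AgreesOn t a α = ∀ {u} → u ∈ frontier t → α u ≡ a u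

    Segment : ℕ → ℕ → (Fin (N C) → Bool) → (Fin (N C) → Bool) → Set
    Segment t t′ a b = Σ (Fin (N C) → Bool) λ α → AgreesOn t a α × AgreesOn t′ b α × Consistent t t′ α

    segment-glue : ∀ {t₁ t₂ t₃ a b c} → t₁ ≤ t₂ → t₂ ≤ t₃ →
      Segment t₁ t₂ a c → Segment t₂ t₃ c b → Segment t₁ t₃ a b
    segment-glue {t₁} {t₂} {t₃} {a} {b} {c} le₁₂ le₂₃ (α₁ , a≈α₁ , c≈α₁ , ok₁) (α₂ , c≈α₂ , b≈α₂ , ok₂) =
      α , a≈α , b≈α , ok
      where
      α : Fin (N C) → Bool
      α u = if settled t₂ u then α₁ u else α₂ u

      α-settled : ∀ {u} → settled t₂ u ≡ true → α u ≡ α₁ u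
      α-settled st rewrite st = refl

      α-unsettled : ∀ {u} → settled t₂ u ≡ false → α u ≡ α₂ u
      α-unsettled ¬st rewrite ¬st = refl

      α₁≈α₂ : ∀ {u} → u ∈ frontier t₂ → α₁ u ≡ α₂ u
      α₁≈α₂ u∈ = trans (c≈α₁ u∈) (sym (c≈α₂ u∈))

      a≈α : AgreesOn t₁ a α
      a≈α u∈ = trans (α-settled (settled-mono le₁₂ (frontier-settled u∈))) (a≈α₁ u∈)

      b≈α : AgreesOn t₃ b α
      b≈α {u} u∈ with true-or-false (settled t₂ u)
      ... | inj₁ st  = trans (α-settled st) (trans (α₁≈α₂ (frontier-settled-earlier le₂₃ u∈ st)) (b≈α₂ u∈))
      ... | inj₂ ¬st = trans (α-unsettled ¬st) (b≈α₂ u∈)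

      -- A child of a gate computed after t₂ is either computed after t₂ as
      -- well, or is remembered on the frontier at t₂.
      α₂≈α-children : ∀ {u} → settled t₂ u ≡ false → ∀ {c} → c ∈ children (node u) → α₂ c ≡ α c
      α₂≈α-children {u} ¬st c∈ with true-or-false (settled t₂ _)
      ... | inj₁ st = trans (sym (α₁≈α₂ (settled-edge⇒frontier st (child⇒edge (nodes C) u c∈) t₂<Lu)))
                            (sym (α-settled st))
        where
        t₂<Lu : t₂ < L u
        t₂<Lu = unsettled-gate⇒< (child⇒isGate (node u) c∈) ¬st
      ... | inj₂ ¬stc = sym (α-unsettled ¬stc)

      ok : Consistent t₁ t₃ α
      ok u rel ¬st₁ st₃ with true-or-false (settled t₂ u)
      ... | inj₁ st₂ = subst (NodeCorrect (node u) x α) (sym (α-settled st₂))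
        (NodeCorrect-local (node u) x (λ c∈ → sym (α-settled (children-settled st₂ c∈))) (ok₁ u rel ¬st₁ st₂))
      ... | inj₂ ¬st₂ = subst (NodeCorrect (node u) x α) (sym (α-unsettled ¬st₂))
        (NodeCorrect-local (node u) x (α₂≈α-children ¬st₂) (ok₂ u rel ¬st₂ st₃))

    segment-split : ∀ {t₁ t₂ t₃ a b c} → t₁ ≤ t₂ → t₂ ≤ t₃ → ((α , _) : Segment t₁ t₃ a b) → AgreesOn t₂ c α →
      Segment t₁ t₂ a c × Segment t₂ t₃ c b
    segment-split le₁₂ le₂₃ (α , a≈α , b≈α , ok) c≈α =
      (α , a≈α , c≈α , λ u rel ¬st₁ st₂ → ok u rel ¬st₁ (settled-mono le₂₃ st₂)) ,
      (α , c≈α , b≈α , λ u rel ¬st₂ st₃ → ok u rel (unsettled-mono le₁₂ ¬st₂) st₃)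

  relevantNodes : ℕ → ℕ → List (Fin (N C))
  relevantNodes t t′ = frontier t ++ frontier t′ ++ gatesAt t′ ++ concatMap (children ∘ node) (gatesAt t′)

  relevantNodes⁺ˡ : ∀ {t t′ u} → u ∈ frontier t → u ∈ relevantNodes t t′
  relevantNodes⁺ˡ = ∈-++⁺ˡ

  relevantNodes⁺ʳ : ∀ {t t′ u} → u ∈ frontier t′ → u ∈ relevantNodes t t′
  relevantNodes⁺ʳ {t} = ∈-++⁺ʳ (frontier t) ∘ ∈-++⁺ˡ

  relevantNodes⁺-gate : ∀ {t t′ u} → u ∈ gatesAt t′ → u ∈ relevantNodes t t′
  relevantNodes⁺-gate {t} {t′} = ∈-++⁺ʳ (frontier t) ∘ ∈-++⁺ʳ (frontier t′) ∘ ∈-++⁺ˡ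

  relevantNodes⁺-child : ∀ {t t′ u c} → u ∈ gatesAt t′ → c ∈ children (node u) → c ∈ relevantNodes t t′
  relevantNodes⁺-child {t} {t′} u∈ c∈ = ∈-++⁺ʳ (frontier t) (∈-++⁺ʳ (frontier t′) (∈-++⁺ʳ (gatesAt t′)
    (∈-concat⁺′ c∈ (∈-map⁺ (children ∘ node) u∈))))

  frontier-relevant : ∀ {t u} → u ∈ frontier t → Relevant u
  frontier-relevant u∈ with frontier⁻ u∈
  ... | gateAt gate _         = inj₁ gate
  ... | crossing e∈ _ _       = inj₂ (inj₁ (_ , e∈))
  ... | settledOutput refl _  = inj₂ (inj₂ refl)

  relevantNodes-relevant : ∀ {t t′ u} → u ∈ relevantNodes t t′ → Relevant u
  relevantNodes-relevant {t} {t′} u∈ with ∈-++⁻ (frontier t) u∈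
  ... | inj₁ u∈f = frontier-relevant u∈f
  ... | inj₂ u∈r with ∈-++⁻ (frontier t′) u∈r
  ...   | inj₁ u∈f′ = frontier-relevant u∈f′
  ...   | inj₂ u∈g with ∈-++⁻ (gatesAt t′) u∈g
  ...     | inj₁ u∈gates = inj₁ (proj₁ (gatesAt⁻ u∈gates))
  ...     | inj₂ u∈cs with ∈-concat⁻′ (map (children ∘ node) (gatesAt t′)) u∈cs
  ...       | cs , u∈cs′ , cs∈ with ∈-map⁻ (children ∘ node) cs∈
  ...         | v , _ , refl = inj₂ (inj₁ (v , child⇒edge (nodes C) v u∈cs′))

  NoGateBetween : ℕ → ℕ → Set
  NoGateBetween t t′ = ∀ {v} → isGateAt v ≡ true → t < L v → L v ≤ t′ → L v ≡ t′

  new-gate-at : ∀ {t t′ u} → NoGateBetween t t′ → isGateAt u ≡ true →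
    settled t u ≡ false → settled t′ u ≡ true → u ∈ gatesAt t′
  new-gate-at none gate ¬st st = gatesAt⁺ gate (none gate (unsettled-gate⇒< gate ¬st) (settled⇒≤ st))

  new-relevant-listed : ∀ {t t′ u} → NoGateBetween t t′ → Relevant u →
    settled t u ≡ false → settled t′ u ≡ true → u ∈ relevantNodes t t′
  new-relevant-listed {t} {t′} {u} none rel ¬st st with true-or-false (isGateAt u)
  ... | inj₁ gate = relevantNodes⁺-gate (new-gate-at none gate ¬st st)
  ... | inj₂ notGate with rel
  ...   | inj₁ gate = ⊥-elim (false≢true (trans (sym notGate) gate))
  ...   | inj₂ (inj₂ refl) = relevantNodes⁺ʳ (frontier⁺ (settledOutput refl st))
  ...   | inj₂ (inj₁ (v , e∈)) with L v ≤? t′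
  ...     | no  ≰ = relevantNodes⁺ʳ (frontier⁺ (crossing e∈ (settled-input⇒< notGate st) (≰⇒> ≰)))
  ...     | yes ≤ = relevantNodes⁺-child (gatesAt⁺ v-gate (none v-gate t<Lv ≤)) u∈children
    where
    u∈children : u ∈ children (node v)
    u∈children = edge⇒child (nodes C) e∈
    v-gate : isGateAt v ≡ true
    v-gate = child⇒isGate (node v) u∈children
    t<Lv : t < L v
    t<Lv = ≤-<-trans (unsettled⇒≤ ¬st) (valid u v e∈)

  newIn : ℕ → ℕ → Fin (N C) → Bool
  newIn t t′ u = not (settled t u) ∧ settled t′ u

  checkNode : ℕ → ℕ → (Fin (N C) → Bool) → Fin (N C) → Formula n
  checkNode t t′ β u = if newIn t t′ u then correctFormula (node u) β (β u) else cst true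

  agreement : (Fin (N C) → Bool) → (Fin (N C) → Bool) → Fin (N C) → Formula n
  agreement a β u = cst (does (β u Data.Bool.≟ a u))

  checks : ℕ → ℕ → (a b β : Fin (N C) → Bool) → List (Formula n)
  checks t t′ a b β =
    map (agreement a β) (frontier t) ++ map (agreement b β) (frontier t′) ++ map (checkNode t t′ β) (relevantNodes t t′)

  open Assignments (Data.Fin._≟_ {N C}) public

  candidates : ℕ → ℕ → (a b : Fin (N C) → Bool) → List (Formula n)
  candidates t t′ a b = map (⋀ ∘ checks t t′ a b) (assignments (relevantNodes t t′))

  baseFormula : ℕ → ℕ → (a b : Fin (N C) → Bool) → Formula n
  baseFormula t t′ a b = ⋁ (candidates t t′ a b)

  module _ (x : Fin n → Bool) where

    checkNode-sound : ∀ {t t′ β u} → ⟦ checkNode t t′ β u ⟧ x ≡ true →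
      settled t u ≡ false → settled t′ u ≡ true → NodeCorrect (node u) x β (β u)
    checkNode-sound {t} {t′} {β} {u} holds ¬st st rewrite ¬st | st = correctFormula-sound (node u) x β (β u) holds

    checkNode-complete : ∀ {t t′ β u} → (settled t u ≡ false → settled t′ u ≡ true → NodeCorrect (node u) x β (β u)) →
      ⟦ checkNode t t′ β u ⟧ x ≡ true
    checkNode-complete {t} {t′} {β} {u} ok with settled t u | settled t′ u
    ... | true  | _     = refl
    ... | false | false = refl
    ... | false | true  = correctFormula-complete (node u) x β (β u) (ok refl refl)

    baseFormula-sound : ∀ {t t′ a b} → NoGateBetween t t′ → ⟦ baseFormula t t′ a b ⟧ x ≡ true → Segment x t t′ a b
    baseFormula-sound {t} {t′} {a} {b} none holds
      with ⋁-sound x (candidates t t′ a b) holds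
    ... | _ , f∈ , f-holds with ∈-map⁻ (⋀ ∘ checks t t′ a b) f∈
    ...   | β , _ , refl = β , a≈β , b≈β , ok
      where
      passes : ∀ {f} → f ∈ checks t t′ a b β → ⟦ f ⟧ x ≡ true
      passes = ⋀-sound x (checks t t′ a b β) f-holds
      a≈β : AgreesOn x t a β
      a≈β u∈ = does-sound (passes (∈-++⁺ˡ (∈-map⁺ (agreement a β) u∈)))
      b≈β : AgreesOn x t′ b β
      b≈β u∈ = does-sound (passes (∈-++⁺ʳ (map (agreement a β) (frontier t)) (∈-++⁺ˡ (∈-map⁺ (agreement b β) u∈))))
      ok : Consistent x t t′ β
      ok u rel ¬st st = checkNode-sound (passes (∈-++⁺ʳ (map (agreement a β) (frontier t))
        (∈-++⁺ʳ (map (agreement b β) (frontier t′)) (∈-map⁺ (checkNode t t′ β) (new-relevant-listed none rel ¬st st))))) ¬st st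

    baseFormula-complete : ∀ {t t′ a b} → NoGateBetween t t′ → Segment x t t′ a b → ⟦ baseFormula t t′ a b ⟧ x ≡ true
    baseFormula-complete {t} {t′} {a} {b} none (α , a≈α , b≈α , ok) =
      let (β , β∈ , β≈α) = assignments-complete (relevantNodes t t′) α in
      ⋁-complete x (candidates t t′ a b) (∈-map⁺ (⋀ ∘ checks t t′ a b) β∈) (⋀-complete x (checks t t′ a b β) (passes β≈α))
      where
      passes : ∀ {β} → (∀ {u} → u ∈ relevantNodes t t′ → β u ≡ α u) →
               ∀ {f} → f ∈ checks t t′ a b β → ⟦ f ⟧ x ≡ true
      passes {β} β≈α f∈ with ∈-++⁻ (map (agreement a β) (frontier t)) f∈
      ... | inj₁ f∈a with ∈-map⁻ (agreement a β) f∈a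
      ...   | u , u∈ , refl = does-complete (trans (β≈α (relevantNodes⁺ˡ u∈)) (a≈α u∈))
      passes {β} β≈α f∈ | inj₂ f∈r with ∈-++⁻ (map (agreement b β) (frontier t′)) f∈r
      ...   | inj₁ f∈b with ∈-map⁻ (agreement b β) f∈b
      ...     | u , u∈ , refl = does-complete (trans (β≈α (relevantNodes⁺ʳ u∈)) (b≈α u∈))
      passes {β} β≈α f∈ | inj₂ f∈r | inj₂ f∈c with ∈-map⁻ (checkNode t t′ β) f∈c
      ...     | u , u∈ , refl = checkNode-complete λ ¬st st →
        subst (NodeCorrect (node u) x β) (sym (β≈α u∈))
          (NodeCorrect-local (node u) x (λ c∈ → sym (β≈α (child-listed ¬st st c∈)))
            (ok u (relevantNodes-relevant u∈) ¬st st))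
        where
        child-listed : settled t u ≡ false → settled t′ u ≡ true → ∀ {c} → c ∈ children (node u) → c ∈ relevantNodes t t′
        child-listed ¬st st c∈ = relevantNodes⁺-child (new-gate-at none (child⇒isGate (node u) c∈) ¬st st) c∈

  checks-small : ∀ {t t′ a b β f} → f ∈ checks t t′ a b β → registers f ≤ 1 × nodeCount f ≤ 2
  checks-small {t} {t′} {a} {b} {β} f∈ with ∈-++⁻ (map (agreement a β) (frontier t)) f∈
  ... | inj₁ f∈a with ∈-map⁻ (agreement a β) f∈a
  ...   | _ , _ , refl = ≤-refl , s≤s z≤n
  checks-small {t} {t′} {a} {b} {β} f∈ | inj₂ f∈r with ∈-++⁻ (map (agreement b β) (frontier t′)) f∈r
  ...   | inj₁ f∈b with ∈-map⁻ (agreement b β) f∈b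
  ...     | _ , _ , refl = ≤-refl , s≤s z≤n
  checks-small {t} {t′} {a} {b} {β} f∈ | inj₂ f∈r | inj₂ f∈c with ∈-map⁻ (checkNode t t′ β) f∈c
  ...     | u , _ , refl with newIn t t′ u
  ...       | true  = registers-correctFormula (node u) β (β u) , nodeCount-correctFormula (node u) β (β u)
  ...       | false = ≤-refl , s≤s z≤n

  registers-baseFormula : ∀ t t′ a b → registers (baseFormula t t′ a b) ≤ 3
  registers-baseFormula t t′ a b =
    registers-foldBin or false (candidates t t′ a b) λ f∈ →
    let (β , _ , f≡) = ∈-map⁻ (⋀ ∘ checks t t′ a b) f∈ in
    subst (λ f → registers f ≤ 2) (sym f≡)
      (registers-foldBin and true (checks t t′ a b β) (proj₁ ∘ checks-small {t} {t′} {a} {b} {β}))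

  length-children : ∀ {k} (g : Node n m k) → length (children g) ≤ 2
  length-children (input _) = z≤n
  length-children (AND _ _) = ≤-refl
  length-children (OR _ _)  = ≤-refl
  length-children (NOT _)   = s≤s z≤n

  length-concatMap-children : ∀ us → length (concatMap (children ∘ node) us) ≤ 2 * length us
  length-concatMap-children []       = z≤n
  length-concatMap-children (u ∷ us) = begin
      length (children (node u) ++ concatMap (children ∘ node) us)
    ≡⟨ length-++ (children (node u)) ⟩
      length (children (node u)) + length (concatMap (children ∘ node) us)
    ≤⟨ +-mono-≤ (length-children (node u)) (length-concatMap-children us) ⟩
      2 + 2 * length us
    ≡⟨ sym (*-suc 2 (length us)) ⟩
      2 * length (u ∷ us) ∎
    where open ≤-Reasoning

  module WidthBounds (w : ℕ) (width : WidthAtMost C L w) where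

    length-gatesAt : ∀ t → length (gatesAt t) ≤ w
    length-gatesAt t = ≤-trans (m≤m+n _ _) (width t)

    length-frontier : ∀ t → length (frontier t) ≤ suc w
    length-frontier t = begin
        length (gatesAt t ++ map proj₁ (crossingAt t) ++ outputIfSettled t)
      ≡⟨ length-++ (gatesAt t) ⟩
        length (gatesAt t) + length (map proj₁ (crossingAt t) ++ outputIfSettled t)
      ≡⟨ cong (length (gatesAt t) +_) (trans (length-++ (map proj₁ (crossingAt t)))
                                             (cong (_+ length (outputIfSettled t)) (length-map proj₁ (crossingAt t)))) ⟩
        length (gatesAt t) + (length (crossingAt t) + length (outputIfSettled t))
      ≤⟨ +-monoʳ-≤ (length (gatesAt t)) (+-monoʳ-≤ (length (crossingAt t)) length-outputIfSettled) ⟩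
        length (gatesAt t) + (length (crossingAt t) + 1)
      ≡⟨ trans (sym (+-assoc (length (gatesAt t)) _ 1)) (+-comm _ 1) ⟩
        suc (layerWidth C L t)
      ≤⟨ s≤s (width t) ⟩
        suc w ∎
      where
      open ≤-Reasoning
      length-outputIfSettled : length (outputIfSettled t) ≤ 1
      length-outputIfSettled with settled t (output C)
      ... | true  = ≤-refl
      ... | false = z≤n

    length-relevantNodes : ∀ t t′ → length (relevantNodes t t′) ≤ 5 * w + 2
    length-relevantNodes t t′ = begin
        length (frontier t ++ frontier t′ ++ gatesAt t′ ++ concatMap (children ∘ node) (gatesAt t′))
      ≡⟨ trans (length-++ (frontier t)) (cong (length (frontier t) +_)
           (trans (length-++ (frontier t′)) (cong (length (frontier t′) +_) (length-++ (gatesAt t′))))) ⟩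
        length (frontier t) + (length (frontier t′) + (length (gatesAt t′) + length (concatMap (children ∘ node) (gatesAt t′))))
      ≤⟨ +-mono-≤ (length-frontier t) (+-mono-≤ (length-frontier t′) (+-mono-≤ (length-gatesAt t′)
           (≤-trans (length-concatMap-children (gatesAt t′)) (*-monoʳ-≤ 2 (length-gatesAt t′))))) ⟩
        suc w + (suc w + (w + 2 * w))
      ≡⟨ identity w ⟩
        5 * w + 2 ∎
      where
      open ≤-Reasoning
      identity : ∀ w → suc w + (suc w + (w + 2 * w)) ≡ 5 * w + 2
      identity = solve-∀

    length-checks : ∀ t t′ a b β → length (checks t t′ a b β) ≤ 7 * w + 4
    length-checks t t′ a b β = begin
        length (map (agreement a β) (frontier t) ++ map (agreement b β) (frontier t′) ++ map (checkNode t t′ β) (relevantNodes t t′))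
      ≡⟨ trans (length-++ (map (agreement a β) (frontier t))) (cong₂ _+_ (length-map _ (frontier t))
           (trans (length-++ (map (agreement b β) (frontier t′)))
                  (cong₂ _+_ (length-map _ (frontier t′)) (length-map _ (relevantNodes t t′))))) ⟩
        length (frontier t) + (length (frontier t′) + length (relevantNodes t t′))
      ≤⟨ +-mono-≤ (length-frontier t) (+-mono-≤ (length-frontier t′) (length-relevantNodes t t′)) ⟩
        suc w + (suc w + (5 * w + 2))
      ≡⟨ identity w ⟩
        7 * w + 4 ∎
      where
      open ≤-Reasoning
      identity : ∀ w → suc w + (suc w + (5 * w + 2)) ≡ 7 * w + 4
      identity = solve-∀

    nodeCount-baseFormula : ∀ t t′ a b → nodeCount (baseFormula t t′ a b) ≤ 2 ^ sizeExponent w 0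
    nodeCount-baseFormula t t′ a b = begin
        nodeCount (baseFormula t t′ a b)
      ≤⟨ nodeCount-foldBin or false (candidates t t′ a b) each ⟩
        suc (length (candidates t t′ a b) * suc (suc ((7 * w + 4) * 3)))
      ≡⟨ cong (λ l → suc (l * suc (suc ((7 * w + 4) * 3))))
              (trans (length-map _ (assignments (relevantNodes t t′))) (length-assignments (relevantNodes t t′))) ⟩
        suc (2 ^ length (relevantNodes t t′) * suc (suc ((7 * w + 4) * 3)))
      ≤⟨ s≤s (*-monoˡ-≤ _ (^-monoʳ-≤ 2 (length-relevantNodes t t′))) ⟩
        suc (2 ^ (5 * w + 2) * suc (suc ((7 * w + 4) * 3)))
      ≤⟨ sizeExponent-base w ⟩
        2 ^ sizeExponent w 0 ∎
      where
      open ≤-Reasoning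
      each : ∀ {f} → f ∈ candidates t t′ a b → nodeCount f ≤ suc ((7 * w + 4) * 3)
      each f∈ with ∈-map⁻ (⋀ ∘ checks t t′ a b) f∈
      ... | β , _ , refl = ≤-trans (nodeCount-foldBin and true (checks t t′ a b β) (proj₂ ∘ checks-small {t} {t′} {a} {b} {β}))
                                   (s≤s (*-monoˡ-≤ 3 (length-checks t t′ a b β)))

  module Recursion (ts : ℕ → ℕ) (ts-mono : ∀ {p q} → p ≤ q → ts p ≤ ts q)
                   (ts-covers : ∀ {v} → isGateAt v ≡ true → Σ ℕ λ p → ts p ≡ L v) where

    segmentFormula : ℕ → ℕ → (a b : Fin (N C) → Bool) → Formula n
    split : ℕ → ℕ → (a b c : Fin (N C) → Bool) → Formula n
    splits : ℕ → ℕ → (a b : Fin (N C) → Bool) → List (Formula n)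

    segmentFormula zero    i a b = baseFormula (ts i) (ts (i + 1)) a b
    segmentFormula (suc d) i a b = ⋁ (splits d i a b)

    split d i a b c = bin and (segmentFormula d i a c) (segmentFormula d (i + 2 ^ d) c b)

    splits d i a b = map (split d i a b) (assignments (frontier (ts (i + 2 ^ d))))

    noGateBetween : ∀ i → NoGateBetween (ts i) (ts (i + 1))
    noGateBetween i {v} gate ts<L L≤ts with ts-covers gate
    ... | p , tsp≡L with p ≤? i
    ...   | yes p≤i = ⊥-elim (<⇒≱ ts<L (subst (_≤ ts i) tsp≡L (ts-mono p≤i)))
    ...   | no  p≰i = ≤-antisym L≤ts (subst (ts (i + 1) ≤_) tsp≡L (ts-mono (subst (_≤ p) (+-comm 1 i) (≰⇒> p≰i))))

    +-2^-suc : ∀ i d → i + 2 ^ suc d ≡ i + 2 ^ d + 2 ^ d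
    +-2^-suc i d = trans (cong (λ e → i + (2 ^ d + e)) (+-identityʳ (2 ^ d))) (sym (+-assoc i (2 ^ d) (2 ^ d)))

    module _ (x : Fin n → Bool) where

      segmentFormula-sound : ∀ d i {a b} → ⟦ segmentFormula d i a b ⟧ x ≡ true → Segment x (ts i) (ts (i + 2 ^ d)) a b
      segmentFormula-sound zero    i holds = baseFormula-sound x (noGateBetween i) holds
      segmentFormula-sound (suc d) i {a} {b} holds
        with ⋁-sound x (splits d i a b) holds
      ... | _ , f∈ , f-holds with ∈-map⁻ (split d i a b) f∈
      ...   | c , _ , refl = subst (λ j → Segment x (ts i) (ts j) a b) (sym (+-2^-suc i d))
        (segment-glue x (ts-mono (m≤m+n i (2 ^ d))) (ts-mono (m≤m+n (i + 2 ^ d) (2 ^ d)))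
          (segmentFormula-sound d i (∧-conicalˡ _ _ f-holds))
          (segmentFormula-sound d (i + 2 ^ d) (∧-conicalʳ _ _ f-holds)))

      segmentFormula-complete : ∀ d i {a b} → Segment x (ts i) (ts (i + 2 ^ d)) a b → ⟦ segmentFormula d i a b ⟧ x ≡ true
      segmentFormula-complete zero    i seg = baseFormula-complete x (noGateBetween i) seg
      segmentFormula-complete (suc d) i {a} {b} seg =
        let (c , c∈ , c≈α) = assignments-complete (frontier (ts (i + 2 ^ d))) (proj₁ seg′)
            (left , right) = segment-split x (ts-mono (m≤m+n i (2 ^ d))) (ts-mono (m≤m+n (i + 2 ^ d) (2 ^ d)))
                                           seg′ (sym ∘ c≈α)
        in ⋁-complete x (splits d i a b)
             (∈-map⁺ (split d i a b) c∈)
             (cong₂ _∧_ (segmentFormula-complete d i left) (segmentFormula-complete d (i + 2 ^ d) right))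
        where
        seg′ : Segment x (ts i) (ts (i + 2 ^ d + 2 ^ d)) a b
        seg′ = subst (λ j → Segment x (ts i) (ts j) a b) (+-2^-suc i d) seg

    registers-segmentFormula : ∀ d i a b → registers (segmentFormula d i a b) ≤ 3 + 2 * d
    registers-segmentFormula zero    i a b = registers-baseFormula (ts i) (ts (i + 1)) a b
    registers-segmentFormula (suc d) i a b = ≤-trans
      (registers-foldBin or false (splits d i a b) each)
      (≤-reflexive (cong (3 +_) (sym (*-suc 2 d))))
      where
      each : ∀ {f} → f ∈ splits d i a b → registers f ≤ suc (3 + 2 * d)
      each f∈ with ∈-map⁻ (split d i a b) f∈
      ... | c , _ , refl = ⊔-lub (≤-trans (registers-segmentFormula d i a c) (n≤1+n _))
                                 (s≤s (registers-segmentFormula d (i + 2 ^ d) c b))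

    module _ (w : ℕ) (width : WidthAtMost C L w) where
      open WidthBounds w width

      nodeCount-segmentFormula : ∀ d i a b → nodeCount (segmentFormula d i a b) ≤ 2 ^ sizeExponent w d
      nodeCount-segmentFormula zero    i a b = nodeCount-baseFormula (ts i) (ts (i + 1)) a b
      nodeCount-segmentFormula (suc d) i a b = begin
          nodeCount (⋁ (splits d i a b))
        ≤⟨ nodeCount-foldBin or false (splits d i a b) each ⟩
          suc (length (splits d i a b) * suc (suc (2 ^ E + 2 ^ E)))
        ≡⟨ cong (λ l → suc (l * suc (suc (2 ^ E + 2 ^ E))))
                (trans (length-map _ (assignments (frontier (ts (i + 2 ^ d))))) (length-assignments (frontier (ts (i + 2 ^ d))))) ⟩
          suc (2 ^ length (frontier (ts (i + 2 ^ d))) * suc (suc (2 ^ E + 2 ^ E)))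
        ≤⟨ s≤s (*-monoˡ-≤ _ (^-monoʳ-≤ 2 (length-frontier (ts (i + 2 ^ d))))) ⟩
          suc (2 ^ suc w * suc (suc (2 ^ E + 2 ^ E)))
        ≤⟨ sizeExponent-step w d ⟩
          2 ^ sizeExponent w (suc d) ∎
        where
        open ≤-Reasoning
        E : ℕ
        E = sizeExponent w d
        each : ∀ {f} → f ∈ splits d i a b → nodeCount f ≤ suc (2 ^ E + 2 ^ E)
        each f∈ with ∈-map⁻ (split d i a b) f∈
        ... | c , _ , refl = ≤-trans (≤-reflexive (nodeCount-bin and (segmentFormula d i a c) _))
          (s≤s (+-mono-≤ (nodeCount-segmentFormula d i a c) (nodeCount-segmentFormula d (i + 2 ^ d) c b)))

-- Thresholds: the sorted gate layers

nthOr : List ℕ → ℕ → ℕ → ℕ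
nthOr []       p       d = d
nthOr (z ∷ zs) zero    d = z
nthOr (z ∷ zs) (suc p) d = nthOr zs p d

nthOr-step : ∀ zs d → Linked _≤_ zs → (∀ {z} → z ∈ zs → z ≤ d) → ∀ p → nthOr zs p d ≤ nthOr zs (suc p) d
nthOr-step []           d sorted ≤d p       = ≤-refl
nthOr-step (z ∷ [])     d sorted ≤d zero    = ≤d (here refl)
nthOr-step (z ∷ [])     d sorted ≤d (suc p) = ≤-refl
nthOr-step (z ∷ y ∷ zs) d (z≤y ∷ sorted) ≤d zero    = z≤y
nthOr-step (z ∷ y ∷ zs) d (z≤y ∷ sorted) ≤d (suc p) = nthOr-step (y ∷ zs) d sorted (≤d ∘ there) p

nthOr-beyond : ∀ zs d {p} → length zs ≤ p → nthOr zs p d ≡ d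
nthOr-beyond []       d _         = refl
nthOr-beyond (z ∷ zs) d (s≤s len≤) = nthOr-beyond zs d len≤

nthOr-∈ : ∀ zs d {z} → z ∈ zs → Σ ℕ λ p → nthOr zs p d ≡ z
nthOr-∈ (z ∷ zs) d (here refl) = 0 , refl
nthOr-∈ (y ∷ zs) d (there z∈)  = let (p , eq) = nthOr-∈ zs d z∈ in suc p , eq

step⇒mono : (f : ℕ → ℕ) → (∀ p → f p ≤ f (suc p)) → ∀ {p q} → p ≤ q → f p ≤ f q
step⇒mono f step p≤q = go (≤⇒≤′ p≤q)
  where
  go : ∀ {p q} → p ≤′ q → f p ≤ f q
  go ≤′-refl       = ≤-refl
  go (≤′-step p≤q) = ≤-trans (go p≤q) (step _)

module Thresholds (zs : List ℕ) (T : ℕ) (zs≤T : ∀ {z} → z ∈ zs → z ≤ T) where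

  open Data.List.Sort ≤-decTotalOrder using (sort; sort-↭; sort-↗)

  threshold : ℕ → ℕ
  threshold p = nthOr (0 ∷ sort zs) p T

  threshold-mono : ∀ {p q} → p ≤ q → threshold p ≤ threshold q
  threshold-mono = step⇒mono threshold (nthOr-step (0 ∷ sort zs) T sorted ≤T)
    where
    sorted : Linked _≤_ (0 ∷ sort zs)
    sorted with sort zs | sort-↗ zs
    ... | []     | _    = [-]
    ... | _ ∷ _  | rest = z≤n ∷ rest
    ≤T : ∀ {z} → z ∈ 0 ∷ sort zs → z ≤ T
    ≤T (here refl) = z≤n
    ≤T (there z∈)  = zs≤T (∈-resp-↭ (sort-↭ zs) z∈)

  threshold-covers : ∀ {z} → z ∈ zs → Σ ℕ λ p → threshold p ≡ z
  threshold-covers z∈ = let (p , eq) = nthOr-∈ (sort zs) T (∈-resp-↭ (↭-sym (sort-↭ zs)) z∈) in suc p , eq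

  threshold-beyond : ∀ {p} → suc (length zs) ≤ p → threshold p ≡ T
  threshold-beyond len≤ = nthOr-beyond (0 ∷ sort zs) T (subst (λ l → suc l ≤ _) (sym (↭-length (sort-↭ zs))) len≤)

-- The whole circuit as one segment

module WholeCircuit {n m : ℕ} (C : Circuit n m) (L : Layering C) (valid : ValidLayering C L) where

  open Segments C L valid

  top : ℕ
  top = suc (max 0 (map L (allFin (N C))))

  L<top : ∀ u → L u < top
  L<top u = s≤s (All.lookup (xs≤max 0 (map L (allFin (N C)))) (∈-map⁺ L (∈-allFin u)))

  unsettled-at-0 : ∀ u → settled 0 u ≡ false
  unsettled-at-0 u with true-or-false (isGateAt u) | settled 0 u in st
  ... | _            | false = refl
  ... | inj₂ notGate | true  = ⊥-elim (n≮0 (settled-input⇒< notGate st))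
  ... | inj₁ gate    | true  =
    let (c , c∈) = isGate⇒child (node u) gate in ⊥-elim (n≮0 (<-≤-trans (child< u c∈) (settled⇒≤ st)))

  settled-at-top : ∀ u → settled top u ≡ true
  settled-at-top u = settled-< (L<top u)

  frontier-top : ∀ {u} → u ∈ frontier top → u ≡ output C
  frontier-top u∈ with frontier⁻ u∈
  ... | gateAt _ at                 = ⊥-elim (<⇒≢ (L<top _) at)
  ... | crossing {v} _ _ top<Lv     = ⊥-elim (<⇒≱ top<Lv (<⇒≤ (L<top v)))
  ... | settledOutput u≡out _       = u≡out

  allTrue : Fin (N C) → Bool
  allTrue _ = true

  module _ (x : Fin n → Bool) where

    run⇒segment : (Σ (Fin m → Bool) λ y → eval C x y ≡ true) → Segment x 0 top allTrue allTrue
    run⇒segment (y , accepts) =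
      V , agree0 , agreeTop , λ u _ _ _ → nodeValue⇒NodeCorrect (node u) x V y (values-nodeAt (nodes C) x y u)
      where
      V : Fin (N C) → Bool
      V = lookup (values (nodes C) x y)
      agree0 : AgreesOn x 0 allTrue V
      agree0 u∈ = ⊥-elim (false≢true (trans (sym (unsettled-at-0 _)) (frontier-settled u∈)))
      agreeTop : AgreesOn x top allTrue V
      agreeTop u∈ rewrite frontier-top u∈ = accepts

    -- The guesses are read off the segment; every relevant node then has its
    -- true value, by induction along the layers.
    segment⇒run : GuessOnce C → Segment x 0 top allTrue allTrue → Σ (Fin m → Bool) λ y → eval C x y ≡ true
    segment⇒run once (α , _ , agreeTop , ok) = y , trans (V≡α (output C) (inj₂ (inj₂ refl))) (agreeTop out∈)
      where
      y : Fin m → Bool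
      y = guessValue (nodes C) α
      V : Fin (N C) → Bool
      V = lookup (values (nodes C) x y)
      out∈ : output C ∈ frontier top
      out∈ = frontier⁺ (settledOutput refl (settled-at-top (output C)))
      V≡α : ∀ u → Relevant u → V u ≡ α u
      V≡α u = <-rec (λ l → ∀ u → L u ≡ l → Relevant u → V u ≡ α u) step (L u) u refl
        where
        step : ∀ l → (∀ {l′} → l′ < l → ∀ u → L u ≡ l′ → Relevant u → V u ≡ α u) →
               ∀ u → L u ≡ l → Relevant u → V u ≡ α u
        step l rec u refl rel = begin
            V u
          ≡⟨ values-nodeAt (nodes C) x y u ⟩
            nodeValue (node u) V x y
          ≡⟨ nodeValue-local (node u) x y
               (λ {c} c∈ → rec (child< u c∈) c refl (inj₂ (inj₁ (u , child⇒edge (nodes C) u c∈)))) ⟩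
            nodeValue (node u) α x y
          ≡⟨ sym (NodeCorrect⇒nodeValue (node u) x α y (ok u rel (unsettled-at-0 u) (settled-at-top u))
                    (λ at → sym (guessValue-correct (nodes C) α u _ (once _) at))) ⟩
            α u ∎
          where open ≡-Reasoning

  gateLayers : List ℕ
  gateLayers = map L (filterᵇ (lookup (gateFlags (nodes C))) (allFin (N C)))

  gateLayers≤top : ∀ {z} → z ∈ gateLayers → z ≤ top
  gateLayers≤top z∈ with ∈-map⁻ L z∈
  ... | u , _ , refl = <⇒≤ (L<top u)

  open Thresholds gateLayers top gateLayers≤top

  gate-layer-covered : ∀ {v} → isGateAt v ≡ true → Σ ℕ λ p → threshold p ≡ L v
  gate-layer-covered {v} gate = threshold-covers (∈-map⁺ L (∈-filter⁺ (T? ∘ lookup (gateFlags (nodes C)))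
    (∈-allFin v) (≡true⇒T (trans (gateFlags-nodeAt (nodes C) v) gate))))

  open Recursion threshold threshold-mono gate-layer-covered

  depth : ℕ
  depth = lg (size C)

  1≤depth : 1 ≤ depth
  1≤depth = ⌈log₂⌉-mono-≤ {2} (m≤n+m 2 (size C))

  formula : Formula n
  formula = segmentFormula depth 0 allTrue allTrue

  threshold-2^depth : threshold (2 ^ depth) ≡ top
  threshold-2^depth = threshold-beyond (begin
      suc (length gateLayers)
    ≡⟨ cong suc (length-map L (filterᵇ (lookup (gateFlags (nodes C))) (allFin (N C)))) ⟩
      suc (size C)
    ≤⟨ ≤-trans (n≤1+n _) (≤-reflexive (+-comm 2 (size C))) ⟩
      size C + 2
    ≤⟨ n≤2^⌈log₂n⌉ (size C + 2) ⟩
      2 ^ depth ∎)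
    where open ≤-Reasoning

  formula-correct : GuessOnce C → ∀ x → (⟦ formula ⟧ x ≡ true) ⇔ (Σ (Fin m → Bool) λ y → eval C x y ≡ true)
  formula-correct once x = mk⇔
    (λ holds → segment⇒run x once (subst (λ t → Segment x 0 t allTrue allTrue) threshold-2^depth
                                         (segmentFormula-sound x depth 0 holds)))
    (λ run → segmentFormula-complete x depth 0 (subst (λ t → Segment x 0 t allTrue allTrue) (sym threshold-2^depth)
                                                      (run⇒segment x run)))

  formula-size : ∀ w → WidthAtMost C L w → nodeCount formula ≤ 2 ^ (11 * ((w + depth) * depth))
  formula-size w width =
    ≤-trans (nodeCount-segmentFormula w width depth 0 allTrue allTrue) (^-monoʳ-≤ 2 (sizeExponent≤ w depth 1≤depth))

  formula-registers : ∀ w → registers formula ≤ w + 11 * depth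
  formula-registers w = ≤-trans (registers-segmentFormula depth 0 allTrue allTrue) (width≤ w depth 1≤depth)

theorem3 : Σ ℕ λ c →
    ∀ (n m : ℕ) (C : Circuit n m) (L : Layering C) (w : ℕ) →
    GuessOnce C → ValidLayering C L → WidthAtMost C L w →
    Σ (Circuit n 0) λ D → Σ (Layering D) λ L′ →
      ValidLayering D L′
      × size D ≤ 2 ^ (c * ((w + lg (size C)) * lg (size C)))
      × WidthAtMost D L′ (w + c * lg (size C))
      × ((x : Fin n → Bool) →
           (eval D x noGuess ≡ true) ⇔ (Σ (Fin m → Bool) λ y → eval C x y ≡ true))
theorem3 = 11 , λ n m C L w once valid width →
  compile (formula C L valid) , toℕ , compile-valid (formula C L valid) ,
  ≤-trans (compile-size (formula C L valid)) (formula-size C L valid w width) ,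
  (λ ℓ → ≤-trans (compile-width (formula C L valid) ℓ) (formula-registers C L valid w)) ,
  λ x → subst (λ b → (b ≡ true) ⇔ _) (sym (compile-eval (formula C L valid) x)) (formula-correct C L valid once x)
  where
  open WholeCircuit using (formula; formula-size; formula-registers; formula-correct)
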